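{- Let $G$ be any of the six non-isomorphic graphs on $10$ vertices that do not contain $E_4$ as a vertex-minor (in graph6 format: \texttt{ICQ`fm\}\textasciitilde w}, \texttt{ICQ`fn\}no}, \texttt{ICQdbh\{NO}, \texttt{ICQb`pzlw}, \texttt{ICQb`twlw}, \texttt{IUZ\textasciitilde vz\}\}o}). Then: (i) $G$ is connected, non-planar, and has girth $3$; (ii) $G$ has clique number $\omega(G)=4$ and rank-width $2$; (iii) $\alpha(G)\leq 3$; (iv) $G$ is not isomorphic to the Petersen graph or to its complement; (v) $G$ is not a circle graph; in fact $G$ contains the wheel $W_5$ as a vertex-minor.
   Context: All graphs are finite and simple; $\alpha$ and $\omega$ denote independence and clique number. For a vertex $v$ of $G$, the local complementation $G*v$ is obtained from $G$ by complementing the induced subgraph on the neighborhood $N_G(v)$, all other edges unchanged. The LC orbit $[G]_{\mathrm{LC}}$ is the set of graphs obtained from $G$ by finite sequences of local complementations. A graph $H$ is a vertex-minor of $G$ if $H$ is isomorphic to an induced subgraph of some graph in $[G]_{\mathrm{LC}}$. $E_4$ is the edgeless graph on $4$ vertices. $W_5$ is the wheel on $6$ vertices (a cycle $C_5$ plus a vertex adjacent to all its vertices). A circle graph is the intersection graph of a finite set of chords of a circle. Rank-width is the standard graph width parameter of Oum and Seymour. -}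

module Defs where

open import Data.Nat using (ℕ; zero; suc; _+_; _*_; _∸_; _≤_; _<_; _<ᵇ_; _≡ᵇ_)
open import Data.Nat.Properties using (<ᵇ⇒<; <-asym)
open import Data.Bool using (Bool; true; false; not; _∧_; _∨_; _xor_; if_then_else_)
open import Data.Bool.Properties using (∧-comm)
open import Data.Fin using (Fin; toℕ; inject₁; fromℕ) renaming (zero to fzero; suc to fsuc)
open import Data.Fin.Properties using () renaming (_≟_ to _≟ᶠ_)
open import Data.List using (List; []; _∷_; length; foldr; concatMap; map)
open import Data.Nat.ListAction using (sum)
open import Data.List.Membership.Propositional using (_∈_)
open import Data.List.Relation.Unary.Any using (Any)
open import Data.List.Relation.Unary.All using (All)
open import Data.List.Relation.Unary.AllPairs using (AllPairs)
open import Data.List.Relation.Unary.Unique.Propositional using (Unique)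
open import Data.Fin.Base using () renaming (_↑ˡ_ to _↑ˡ_)
open import Data.List.Base using () renaming (allFin to allFinL)
open import Data.Product using (Σ; ∃; ∃-syntax; _×_; _,_; proj₁; proj₂)
open import Data.Sum using (_⊎_)
open import Data.Empty using (⊥; ⊥-elim)
open import Data.Unit using (tt)
open import Data.Char using (Char) renaming (toℕ to charToℕ)
open import Data.String using (String; toList)
open import Function.Bundles using (_↔_; Inverse)
open import Function.Definitions using (Injective)
open import Relation.Nullary using (¬_; yes; no)
open import Relation.Nullary.Decidable using (⌊_⌋)
open import Relation.Binary.PropositionalEquality using (_≡_; _≢_; refl; sym; trans; cong; subst)

record Graph (n : ℕ) : Set where
  field
    adj        : Fin n → Fin n → Bool
    adj-sym    : ∀ i j → adj i j ≡ adj j i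
    adj-irrefl : ∀ i → adj i i ≡ false
open Graph public

sym2 : (ℕ → ℕ → Bool) → ℕ → ℕ → Bool
sym2 f m k = if m <ᵇ k then f m k else (if k <ᵇ m then f k m else false)

private
  <ᵇ-irrefl : ∀ m → (m <ᵇ m) ≡ false
  <ᵇ-irrefl zero = refl
  <ᵇ-irrefl (suc m) = <ᵇ-irrefl m

  asymᵇ : ∀ m k → (m <ᵇ k) ≡ true → (k <ᵇ m) ≡ true → ⊥
  asymᵇ m k p q = <-asym (<ᵇ⇒< m k (subst (λ b → Data.Bool.T b) (sym p) tt))
                         (<ᵇ⇒< k m (subst (λ b → Data.Bool.T b) (sym q) tt))

  sym2-sym : ∀ f m k → sym2 f m k ≡ sym2 f k m
  sym2-sym f m k with m <ᵇ k in e1 | k <ᵇ m in e2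
  ... | true  | true  = ⊥-elim (asymᵇ m k e1 e2)
  ... | true  | false = refl
  ... | false | true  = refl
  ... | false | false = refl

  sym2-irrefl : ∀ f m → sym2 f m m ≡ false
  sym2-irrefl f m rewrite <ᵇ-irrefl m = refl

fromUpper : (n : ℕ) → (ℕ → ℕ → Bool) → Graph n
fromUpper n f = record
  { adj        = λ i j → sym2 f (toℕ i) (toℕ j)
  ; adj-sym    = λ i j → sym2-sym f (toℕ i) (toℕ j)
  ; adj-irrefl = λ i → sym2-irrefl f (toℕ i) }

-- graph6 decoding (standard format, n ≤ 62): after the header byte, the
-- bits of the upper triangle, ordered (0,1),(0,2),(1,2),(0,3),(1,3),(2,3),...
-- are packed 6 per character (value = code - 63), most significant bit first.

bits6 : ℕ → List Bool
bits6 x = go 6 x []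
  where
  go : ℕ → ℕ → List Bool → List Bool
  go zero    y acc = acc
  go (suc k) y acc = go k (Data.Nat._/_ y 2) ((Data.Nat._≡ᵇ_ (Data.Nat._%_ y 2) 1) ∷ acc)

g6bits : List Char → List Bool
g6bits []       = []
g6bits (_ ∷ cs) = concatMap (λ c → bits6 (charToℕ c ∸ 63)) cs

g6header : String → ℕ
g6header s with toList s
... | []    = 0
... | c ∷ _ = charToℕ c ∸ 63

nth : List Bool → ℕ → Bool
nth []       _       = false
nth (b ∷ _)  zero    = b
nth (_ ∷ bs) (suc k) = nth bs k

tri : ℕ → ℕ
tri zero    = 0
tri (suc j) = tri j + j

graph6 : (n : ℕ) → String → Graph n
graph6 n s = fromUpper n (λ i j → nth (g6bits (toList s)) (tri j + i))

G1 G2 G3 G4 G5 G6 : Graph 10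
G1 = graph6 10 "ICQ`fm}~w"
G2 = graph6 10 "ICQ`fn}no"
G3 = graph6 10 "ICQdbh{NO"
G4 = graph6 10 "ICQb`pzlw"
G5 = graph6 10 "ICQb`twlw"
G6 = graph6 10 "IUZ~vz}}o"

private
  hdr : map g6header ("ICQ`fm}~w" ∷ "ICQ`fn}no" ∷ "ICQdbh{NO" ∷ "ICQb`pzlw" ∷ "ICQb`twlw" ∷ "IUZ~vz}}o" ∷ [])
        ≡ 10 ∷ 10 ∷ 10 ∷ 10 ∷ 10 ∷ 10 ∷ []
  hdr = refl

sixGraphs : List (Graph 10)
sixGraphs = G1 ∷ G2 ∷ G3 ∷ G4 ∷ G5 ∷ G6 ∷ []

countL : {A : Set} → (A → Bool) → List A → ℕ
countL p []       = 0
countL p (x ∷ xs) = (if p x then 1 else 0) + countL p xs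

allV : (n : ℕ) → List (Fin n)
allV n = allFinL n

numEdges : {n : ℕ} → Graph n → ℕ
numEdges {n} G = sum (map (λ i → countL (λ j → adj G i j ∧ (toℕ i <ᵇ toℕ j)) (allV n)) (allV n))

numIsolated : {n : ℕ} → Graph n → ℕ
numIsolated {n} G = countL (λ v → countL (adj G v) (allV n) ≡ᵇ 0) (allV n)

_≅_ : {n m : ℕ} → Graph n → Graph m → Set
_≅_ {n} {m} G H = Σ (Fin n ↔ Fin m) λ f →
  ∀ i j → adj G i j ≡ adj H (Inverse.to f i) (Inverse.to f j)

private
  ≟-refl : ∀ {n} (i : Fin n) → ⌊ i ≟ᶠ i ⌋ ≡ true
  ≟-refl i with i ≟ᶠ i
  ... | yes _ = refl
  ... | no ¬p = ⊥-elim (¬p refl)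

  ≟-sym : ∀ {n} (i j : Fin n) → ⌊ i ≟ᶠ j ⌋ ≡ ⌊ j ≟ᶠ i ⌋
  ≟-sym i j with i ≟ᶠ j | j ≟ᶠ i
  ... | yes _ | yes _ = refl
  ... | yes p | no ¬q = ⊥-elim (¬q (sym p))
  ... | no ¬p | yes q = ⊥-elim (¬p (sym q))
  ... | no _  | no _  = refl

complement : {n : ℕ} → Graph n → Graph n
complement G = record
  { adj        = λ i j → not (adj G i j) ∧ not ⌊ i ≟ᶠ j ⌋
  ; adj-sym    = λ i j → trans (cong (λ b → not b ∧ not ⌊ i ≟ᶠ j ⌋) (adj-sym G i j))
                               (cong (λ b → not (adj G j i) ∧ not b) (≟-sym i j))
  ; adj-irrefl = λ i → trans (cong (λ b → not (adj G i i) ∧ not b) (≟-refl i))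
                             (Data.Bool.Properties.∧-zeroʳ (not (adj G i i))) }

-- Petersen graph: outer 5-cycle 0..4 (i ~ i±1 mod 5), inner pentagram
-- 5..9 (5+a ~ 5+b iff b-a ≡ ±2 mod 5), spokes i ~ 5+i.
petersenUpper : ℕ → ℕ → Bool
petersenUpper i j =
  ((j <ᵇ 5) ∧ ((j ∸ i ≡ᵇ 1) ∨ (j ∸ i ≡ᵇ 4)))
  ∨ ((i <ᵇ 5) ∧ (j ≡ᵇ i + 5))
  ∨ ((4 <ᵇ i) ∧ ((j ∸ i ≡ᵇ 2) ∨ (j ∸ i ≡ᵇ 3)))

Petersen : Graph 10
Petersen = fromUpper 10 petersenUpper

-- Wheel W5: hub 0 adjacent to all of 1..5, which form the 5-cycle 1-2-3-4-5-1
W5 : Graph 6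
W5 = fromUpper 6 (λ i j → (i ≡ᵇ 0) ∨ (j ∸ i ≡ᵇ 1) ∨ ((i ≡ᵇ 1) ∧ (j ≡ᵇ 5)))

private
  xor-lemma : ∀ a b c d e f → a ≡ d → b ≡ e → c ≡ f →
              a xor (b ∧ c) ≡ d xor (e ∧ f)
  xor-lemma a b c .a .b .c refl refl refl = refl

_⋆_ : {n : ℕ} → Graph n → Fin n → Graph n
G ⋆ v = record
  { adj        = λ x y → adj G x y xor ((adj G v x ∧ adj G v y) ∧ not ⌊ x ≟ᶠ y ⌋)
  ; adj-sym    = λ x y → xor-lemma (adj G x y) (adj G v x ∧ adj G v y) (not ⌊ x ≟ᶠ y ⌋)
                           (adj G y x) (adj G v y ∧ adj G v x) (not ⌊ y ≟ᶠ x ⌋)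
                           (adj-sym G x y) (∧-comm (adj G v x) (adj G v y))
                           (cong not (≟-sym x y))
  ; adj-irrefl = λ x → trans (cong (λ b → adj G x x xor ((adj G v x ∧ adj G v x) ∧ not b)) (≟-refl x))
                        (trans (cong (λ b → b xor ((adj G v x ∧ adj G v x) ∧ false)) (adj-irrefl G x))
                               (Data.Bool.Properties.∧-zeroʳ (adj G v x ∧ adj G v x))) }

data LCReach {n : ℕ} : Graph n → Graph n → Set where
  lc-done : ∀ {G} → LCReach G G
  lc-step : ∀ {G H} (v : Fin n) → LCReach (G ⋆ v) H → LCReach G H

VertexMinor : {m n : ℕ} → Graph m → Graph n → Set
VertexMinor {m} {n} H G = Σ (Graph n) λ G' → LCReach G G' ×
  Σ (Fin m → Fin n) λ f → Injective _≡_ _≡_ f × (∀ i j → adj H i j ≡ adj G' (f i) (f j))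

data Walk {n : ℕ} (G : Graph n) : Fin n → Fin n → Set where
  here : ∀ {u} → Walk G u u
  step : ∀ {u w v} → adj G u w ≡ true → Walk G w v → Walk G u v

Connected : {n : ℕ} → Graph n → Set
Connected {n} G = ∀ (u v : Fin n) → Walk G u v

HasCycle : {n : ℕ} → Graph n → ℕ → Set
HasCycle G zero = ⊥
HasCycle G (suc zero) = ⊥
HasCycle G (suc (suc zero)) = ⊥
HasCycle {n} G (suc (suc (suc m))) = Σ (Fin (3 + m) → Fin n) λ c →
  Injective _≡_ _≡_ c ×
  (∀ (i : Fin (2 + m)) → adj G (c (inject₁ i)) (c (fsuc i)) ≡ true) ×
  adj G (c (fromℕ (2 + m))) (c fzero) ≡ true

Girth : {n : ℕ} → Graph n → ℕ → Set
Girth G g = HasCycle G g × (∀ k → HasCycle G k → g ≤ k)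

IsClique : {n : ℕ} → Graph n → List (Fin n) → Set
IsClique G xs = Unique xs × AllPairs (λ a b → adj G a b ≡ true) xs

IsIndependent : {n : ℕ} → Graph n → List (Fin n) → Set
IsIndependent G xs = Unique xs × AllPairs (λ a b → adj G a b ≡ false) xs

CliqueNumber : {n : ℕ} → Graph n → ℕ → Set
CliqueNumber G k = (Σ _ λ xs → IsClique G xs × length xs ≡ k) ×
                   (∀ xs → IsClique G xs → length xs ≤ k)

IndependenceNumber : {n : ℕ} → Graph n → ℕ → Set
IndependenceNumber G k = (Σ _ λ xs → IsIndependent G xs × length xs ≡ k) ×
                         (∀ xs → IsIndependent G xs → length xs ≤ k)

xorSum : (k : ℕ) → (Fin k → Bool) → Bool
xorSum zero    f = false
xorSum (suc k) f = f fzero xor xorSum k (λ i → f (fsuc i))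

-- cut-rank of X is at most k: the rows (indexed by X) of the GF(2) matrix
-- A[X, V∖X] lie in the span of k vectors, i.e. its GF(2)-rank is ≤ k
CutRankAtMost : {n : ℕ} → Graph n → List (Fin n) → ℕ → Set
CutRankAtMost {n} G X k = Σ (Fin k → Fin n → Bool) λ basis →
  ∀ x → x ∈ X → Σ (Fin k → Bool) λ c →
    ∀ y → ¬ (y ∈ X) → adj G x y ≡ xorSum k (λ i → c i ∧ basis i y)

-- rank decompositions: a subcubic tree with leaves in bijection with V,
-- represented as a rooted full binary tree (root of degree 2, internal
-- nodes of degree 3).  Each tree edge corresponds to a non-root subtree;
-- its cut is (leaves of that subtree, the rest).
data BTree (n : ℕ) : Set where
  leaf : Fin n → BTree n
  node : BTree n → BTree n → BTree n

leaves : {n : ℕ} → BTree n → List (Fin n)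
leaves (leaf v)   = v ∷ []
leaves (node l r) = leaves l Data.List.++ leaves r

data Subtree {n : ℕ} : BTree n → BTree n → Set where
  sub-self  : ∀ {t} → Subtree t t
  sub-left  : ∀ {s l r} → Subtree s l → Subtree s (node l r)
  sub-right : ∀ {s l r} → Subtree s r → Subtree s (node l r)

IsRankDecomposition : {n : ℕ} → BTree n → Set
IsRankDecomposition {n} t = Unique (leaves t) × (∀ (v : Fin n) → v ∈ leaves t)

-- rank-width ≤ k (cut of the whole vertex set has rank 0, so including the
-- root in the quantification is harmless)
RankWidthAtMost : {n : ℕ} → Graph n → ℕ → Set
RankWidthAtMost G k = Σ _ λ t → IsRankDecomposition t ×
  (∀ s → Subtree s t → CutRankAtMost G (leaves s) k)

RankWidth : {n : ℕ} → Graph n → ℕ → Set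
RankWidth G k = RankWidthAtMost G k × (∀ j → RankWidthAtMost G j → k ≤ j)

-- Circle graphs: chord of v has endpoints a v < b v (positions along the
-- circle, read from a cut point which is not an endpoint); all endpoints are
-- distinct; two chords intersect iff their endpoints interleave.

ChordsCross : (a b : ℕ) → (c d : ℕ) → Set
ChordsCross a b c d = (a < c × c < b × b < d) ⊎ (c < a × a < d × d < b)

IsCircleGraph : {n : ℕ} → Graph n → Set
IsCircleGraph {n} G = Σ (Fin n → ℕ) λ a → Σ (Fin n → ℕ) λ b →
  (∀ v → a v < b v) ×
  (∀ u v → u ≢ v → (a u ≢ a v) × (a u ≢ b v) × (b u ≢ b v)) ×
  (∀ u v → u ≢ v → (adj G u v ≡ true → ChordsCross (a u) (b u) (a v) (b v))
                 × (ChordsCross (a u) (b u) (a v) (b v) → adj G u v ≡ true))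

iter : {A : Set} → (A → A) → ℕ → A → A
iter f zero    x = x
iter f (suc k) x = f (iter f k x)

-- rotation system: at each vertex v, next v is a cyclic permutation of N(v)
record Rotation {n : ℕ} (G : Graph n) : Set where
  field
    next   : Fin n → Fin n → Fin n
    closed : ∀ v u → adj G v u ≡ true → adj G v (next v u) ≡ true
    inj    : ∀ v u w → adj G v u ≡ true → adj G v w ≡ true → next v u ≡ next v w → u ≡ w
    cyclic : ∀ v u w → adj G v u ≡ true → adj G v w ≡ true →
             Σ ℕ λ k → iter (next v) k u ≡ w
open Rotation public

Dart : {n : ℕ} → Graph n → (Fin n × Fin n) → Set
Dart G (u , v) = adj G u v ≡ true

faceStep : {n : ℕ} {G : Graph n} → Rotation G → Fin n × Fin n → Fin n × Fin n
faceStep ρ (u , v) = (v , next ρ v u)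

SameFace : {n : ℕ} {G : Graph n} → Rotation G → Fin n × Fin n → Fin n × Fin n → Set
SameFace ρ d e = Σ ℕ λ k → iter (faceStep ρ) k d ≡ e

FaceReps : {n : ℕ} {G : Graph n} → Rotation G → List (Fin n × Fin n) → Set
FaceReps {G = G} ρ R = All (Dart G) R ×
  (∀ d → Dart G d → Any (λ r → SameFace ρ r d) R) ×
  AllPairs (λ r r' → ¬ SameFace ρ r r') R

ComponentReps : {n : ℕ} → Graph n → List (Fin n) → Set
ComponentReps {n} G C = (∀ (v : Fin n) → Any (λ c → Walk G c v) C) ×
  AllPairs (λ c c' → ¬ Walk G c c') C

-- G is planar iff it has a rotation system in which every component has
-- Euler genus 0:  V − E + F + (#isolated vertices) = 2·(#components)
Planar : {n : ℕ} → Graph n → Set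
Planar {n} G = Σ (Rotation G) λ ρ → Σ _ λ R → Σ _ λ C →
  FaceReps ρ R × ComponentReps G C ×
  n + length R + numIsolated G ≡ numEdges G + 2 * length C

-- Each graph comes with a small certificate whose validity is decided by evaluation.  Clique and
-- independence numbers are bounded by an exhaustive clique search.  Rank-width ≤ 2 is witnessed by a
-- decomposition whose cut matrices are spanned by two rows each; rank-width ≥ 2 holds because every
-- two vertices have a nonsingular 2 × 2 minor outside themselves, which the cut at a cherry of any
-- decomposition forbids.  The Petersen graph is 3-regular and its complement 6-regular, while each
-- graph has a vertex of another degree.  W5 is an induced subgraph after the local complementations
-- of the certificate, hence a vertex-minor.  It is not a circle graph: local complementation at v
-- reverses the arc inside the chord of v, so circle graphs are closed under it; chords crossing a
-- fixed chord cross each other exactly when their inner and outer endpoints are ordered alike, so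
-- neighbourhoods in circle graphs are permutation graphs; and along the rim C5 of W5 the inner order
-- would have to turn at every vertex of an odd cycle.  Non-planarity is Euler's formula with a
-- refined face count: weighting a dart 3 when the angle it opens at its head is not a triangle and 4
-- otherwise, every face carries weight at least 12 on its first three or four darts, so
-- 12F + (bad angles) ≤ 8E, and the certificate exhibits enough bad angles to contradict F ≥ E + 2 − n.
module Submission where

open import Defs
open import Data.Nat using (ℕ; _≤_)
open import Data.Product using (Σ; _×_)
open import Data.List.Membership.Propositional using (_∈_)
open import Relation.Nullary using (¬_)

open import Algebra.Bundles using (CommutativeRing)
open import Data.Bool using (Bool; true; false; T; not; if_then_else_; _∨_; _∧_; _xor_)
open import Data.Bool.Properties
  using (T?; T-∨; T-≡; ∧-comm; ∧-zeroʳ; ∧-identityʳ; ∧-distribˡ-xor; ∧-distribʳ-xor; xor-comm; xor-identityʳ;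
         xor-∧-commutativeRing; not-¬; ¬-not; not-involutive)
  renaming (_≟_ to _≟ᵇ_)
open import Data.Empty using (⊥; ⊥-elim)
open import Data.Fin using (Fin; zero; suc; #_; _≟_; toℕ; inject₁; combine)
open import Data.Fin.Properties using (all?; any?; suc-injective; pigeonhole; combine-injective)
open import Data.List using (List; []; _∷_; _++_; length; map; filter; foldr; allFin; concatMap; cartesianProduct)
import Data.List as List
open import Data.List.Extrema.Nat using (max; xs≤max)
open import Data.List.Membership.Propositional using (_∉_; find)
open import Data.List.Membership.Propositional.Properties
  using (∈-lookup; ∈-allFin; ∈-filter⁺; ∈-filter⁻; ∈-∃++; ∈-++⁺ˡ; ∈-++⁺ʳ; ∈-++⁻; ∈-map⁺; ∈-map⁻;
         ∈-concatMap⁻; ∈-cartesianProduct⁺)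
open import Data.List.Properties using (length-++; length-map; map-++)
open import Data.List.Relation.Binary.Disjoint.Propositional using (Disjoint)
open import Data.List.Relation.Binary.Permutation.Propositional.Properties using (shift; ↭-length)
  renaming (map⁺ to ↭-map⁺)
open import Data.List.Relation.Binary.Subset.Propositional using (_⊆_)
open import Data.List.Relation.Unary.All as All using (All; []; _∷_)
import Data.List.Relation.Unary.All.Properties as All
open import Data.List.Relation.Unary.AllPairs as AllPairs using (AllPairs; []; _∷_)
open import Data.List.Relation.Unary.Any as Any using (Any; here; there; satisfied)
open import Data.List.Relation.Unary.Unique.Propositional using (Unique)
import Data.List.Relation.Unary.Unique.Propositional.Properties as Unique
open import Data.Maybe using (Maybe; just; nothing; is-just; to-witness-T; _<∣>_)
import Data.Maybe as Maybe
open import Data.Nat using (zero; suc; z≤n; s≤s; s≤s⁻¹; _<_; _+_; _*_; _∸_; _⊓_; _⊔_; _<ᵇ_)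
open import Data.Nat.ListAction using (sum)
open import Data.Nat.ListAction.Properties using (sum-↭; sum-++)
open import Data.Nat.Properties
  using (≤-refl; ≤-antisym; ≤-trans; ≤-total; <-irrefl; <-asym; <-trans; <-≤-trans; ≤-<-trans; <-cmp;
         <⇒≤; <⇒≱; ≮⇒≥; ≤∧≢⇒<; <ᵇ⇒<; <⇒<ᵇ; _<?_; _≤?_; n<1+n; m≤m+n; m≤n+m; m<m+n; m≤n⇒∃[o]m+o≡n;
         +-comm; +-suc; *-suc; *-zeroʳ; +-mono-≤; +-monoˡ-≤; +-monoʳ-≤; +-monoˡ-<; +-monoʳ-<; *-monoʳ-≤;
         m<n⇒0<n∸m; +-∸-assoc; m+[n∸m]≡n; m∸[m∸n]≡n; ∸-monoʳ-<; m⊓n≤m⊔n; m≤n⇒m⊓n≡m; m≥n⇒m⊓n≡n;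
         m≤n⇒m⊔n≡n; m≥n⇒m⊔n≡m; +-commutativeSemigroup; module ≤-Reasoning)
  renaming (_≟_ to _≟ℕ_)
open import Algebra.Properties.CommutativeSemigroup +-commutativeSemigroup using (interchange)
open import Algebra.Properties.CommutativeSemigroup (CommutativeRing.+-commutativeSemigroup xor-∧-commutativeRing)
  using () renaming (interchange to xor-interchange)
open import Data.Nat.Solver using (module +-*-Solver)
open import Data.Product using (_,_; proj₁; proj₂; ∃; ∃₂; uncurry)
open import Data.Product.Properties using (≡-dec)
open import Data.Sum using (_⊎_; inj₁; inj₂)
open import Data.Vec using (Vec; []; _∷_; lookup; replicate)
open import Function using (_∘_)
open import Function.Bundles using (Inverse; Injection; Equivalence)
open import Function.Definitions using (Injective)
open import Function.Properties.Inverse using (↔⇒↣; ↔-sym)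
open import Level using (Level)
open import Relation.Binary using (Rel; Decidable; Symmetric; DecidableEquality; tri<; tri≈; tri>)
open import Relation.Binary.PropositionalEquality
  using (_≡_; _≢_; refl; sym; trans; cong; cong₂; subst; subst₂; ≢-sym; module ≡-Reasoning)
open import Relation.Nullary using (Dec; yes; no)
open import Relation.Nullary.Decidable using (True; toWitness; from-yes; map′; ⌊_⌋; _×-dec_; _→-dec_; ¬?)
open import Relation.Unary using () renaming (Decidable to Decidable₁)

private variable
  ℓ : Level
  A : Set
  n m k : ℕ
  G H : Graph n
  u v w x y z t : A
  xs ys zs cs : List A

true≢false : true ≢ false
true≢false ()

<ᵇ≡true⇒< : ∀ {m n} → (m <ᵇ n) ≡ true → m < n
<ᵇ≡true⇒< {m} {n} m<n = <ᵇ⇒< m n (subst T (sym m<n) _)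

<ᵇ≡false⇒≥ : ∀ {m n} → (m <ᵇ n) ≡ false → n ≤ m
<ᵇ≡false⇒≥ m≮n = ≮⇒≥ (λ m<n → subst T m≮n (<⇒<ᵇ m<n))

<⇒<ᵇ≡true : x < y → (x <ᵇ y) ≡ true
<⇒<ᵇ≡true x<y = Equivalence.to T-≡ (<⇒<ᵇ x<y)

≥⇒<ᵇ≡false : y ≤ x → (x <ᵇ y) ≡ false
≥⇒<ᵇ≡false {y = y} {x = x} y≤x with x <ᵇ y in x<y
... | true  = ⊥-elim (<⇒≱ (<ᵇ≡true⇒< {x} {y} x<y) y≤x)
... | false = refl

⌊≟⌋-false : {u w : Fin n} → u ≢ w → ⌊ u ≟ w ⌋ ≡ false
⌊≟⌋-false {u = u} {w} u≢w with u ≟ w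
... | yes u≡w = ⊥-elim (u≢w u≡w)
... | no _    = refl

∈-remove : v ∈ ys ++ x ∷ zs → v ≢ x → v ∈ ys ++ zs
∈-remove {ys = []}     (here refl) v≢x = ⊥-elim (v≢x refl)
∈-remove {ys = []}     (there p)   _   = p
∈-remove {ys = y ∷ ys} (here refl) _   = here refl
∈-remove {ys = y ∷ ys} (there p)   v≢x = there (∈-remove p v≢x)

∈-insert : v ∈ ys ++ zs → v ∈ ys ++ x ∷ zs
∈-insert {ys = ys} p with ∈-++⁻ ys p
... | inj₁ q = ∈-++⁺ˡ q
... | inj₂ q = ∈-++⁺ʳ ys (there q)

allPairs-remove : ∀ {R : Rel A ℓ} → Symmetric R →
                  AllPairs R (ys ++ x ∷ zs) → All (R x) (ys ++ zs) × AllPairs R (ys ++ zs)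
allPairs-remove {ys = []}     _     (p ∷ ps) = p , ps
allPairs-remove {ys = y ∷ ys} R-sym (p ∷ ps) with allPairs-remove R-sym ps | All.++⁻ ys p
... | q , qs | p₁ , Ryx ∷ p₂ = R-sym Ryx ∷ q , All.++⁺ p₁ p₂ ∷ qs

allPairs-++⁻ : ∀ {R : Rel A ℓ} → AllPairs R (xs ++ ys) → AllPairs R xs × AllPairs R ys
allPairs-++⁻ {xs = []}     p          = [] , p
allPairs-++⁻ {xs = x ∷ xs} (px ∷ pxs) = let p , q = allPairs-++⁻ pxs in All.++⁻ˡ xs px ∷ p , q

unique? : (xs : List (Fin n)) → Dec (Unique xs)
unique? = AllPairs.allPairs? (λ x y → ¬? (x ≟ y))

_∈?_ : (x : Fin n) (xs : List (Fin n)) → Dec (x ∈ xs)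
x ∈? xs = Any.any? (x ≟_) xs

lookup-injective : Unique xs → Injective _≡_ _≡_ (List.lookup xs)
lookup-injective {xs = x ∷ xs} _          {zero}  {zero}  _ = refl
lookup-injective {xs = x ∷ xs} (x∉xs ∷ _) {zero}  {suc j} e = ⊥-elim (All.lookup x∉xs (∈-lookup j) e)
lookup-injective {xs = x ∷ xs} (x∉xs ∷ _) {suc i} {zero}  e = ⊥-elim (All.lookup x∉xs (∈-lookup i) (sym e))
lookup-injective {xs = x ∷ xs} (_ ∷ uxs)  {suc i} {suc j} e = cong suc (lookup-injective uxs e)

sum-unique-⊆ : (f : A → ℕ) → Unique xs → xs ⊆ ys → sum (map f xs) ≤ sum (map f ys)
sum-unique-⊆ {xs = []}     f _            _   = z≤n
sum-unique-⊆ {xs = x ∷ xs} f (x∉xs ∷ uxs) sub with ∈-∃++ (sub (here refl))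
... | ys₁ , ys₂ , refl = begin
  f x + sum (map f xs)            ≤⟨ +-monoʳ-≤ (f x) (sum-unique-⊆ f uxs xs⊆) ⟩
  f x + sum (map f (ys₁ ++ ys₂))  ≡⟨ sum-↭ (↭-map⁺ f (shift x ys₁ ys₂)) ⟨
  sum (map f (ys₁ ++ x ∷ ys₂))    ∎
  where
  open ≤-Reasoning
  xs⊆ : xs ⊆ ys₁ ++ ys₂
  xs⊆ p = ∈-remove (sub (there p)) (≢-sym (All.lookup x∉xs p))

sum-map-const : ∀ (xs : List A) → sum (map (λ _ → 1) xs) ≡ length xs
sum-map-const []       = refl
sum-map-const (_ ∷ xs) = cong suc (sum-map-const xs)

length-unique-⊆ : Unique xs → xs ⊆ ys → length xs ≤ length ys
length-unique-⊆ {xs = xs} {ys = ys} uxs sub =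
  subst₂ _≤_ (sum-map-const xs) (sum-map-const ys) (sum-unique-⊆ (λ _ → 1) uxs sub)

sum-complementary : ∀ {f g : A → ℕ} {c} → (∀ x → f x + g x ≡ c) →
                    ∀ xs → sum (map f xs) + sum (map g xs) ≡ c * length xs
sum-complementary {c = c} f+g []       = sym (*-zeroʳ c)
sum-complementary {f = f} {g} {c} f+g (x ∷ xs) = begin
  (f x + sum (map f xs)) + (g x + sum (map g xs)) ≡⟨ interchange (f x) _ (g x) _ ⟩
  (f x + g x) + (sum (map f xs) + sum (map g xs)) ≡⟨ cong₂ _+_ (f+g x) (sum-complementary f+g xs) ⟩
  c + c * length xs                               ≡⟨ *-suc c (length xs) ⟨
  c * length (x ∷ xs)                             ∎
  where open ≡-Reasoning

iter-+ : ∀ (f : A → A) m k x → iter f (m + k) x ≡ iter f m (iter f k x)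
iter-+ f zero    k x = refl
iter-+ f (suc m) k x = cong f (iter-+ f m k x)

iter-periodic : ∀ (f : A → A) {p x} → iter f p x ≡ x → ∀ k → iter f (k * p) x ≡ x
iter-periodic f         period zero    = refl
iter-periodic f {p} {x} period (suc k) =
  trans (iter-+ f p (k * p) x) (trans (cong (iter f p) (iter-periodic f period k)) period)

iter-fixed : ∀ (f : A → A) {x} → f x ≡ x → ∀ k → iter f k x ≡ x
iter-fixed f fixed zero    = refl
iter-fixed f fixed (suc k) = trans (cong f (iter-fixed f fixed k)) fixed

module Orbits {N : ℕ} {A : Set} (f : A → A) (D : A → Set)
              (f-closed : ∀ {x} → D x → D (f x))
              (f-injective : ∀ {x y} → D x → D y → f x ≡ f y → x ≡ y)
              (encode : A → Fin N) (encode-injective : ∀ {x y} → encode x ≡ encode y → x ≡ y) where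

  iter-closed : ∀ {x} → D x → ∀ k → D (iter f k x)
  iter-closed dx zero    = dx
  iter-closed dx (suc k) = f-closed (iter-closed dx k)

  iter-cancel : ∀ k {x y} → D x → D y → iter f k x ≡ iter f k y → x ≡ y
  iter-cancel zero    _  _  e = e
  iter-cancel (suc k) dx dy e = iter-cancel k dx dy (f-injective (iter-closed dx k) (iter-closed dy k) e)

  periodic : ∀ {x} → D x → ∃ λ p → iter f (suc p) x ≡ x
  periodic {x} dx with pigeonhole (n<1+n N) (λ k → encode (iter f (toℕ k) x))
  ... | i , j , i<j , same with m≤n⇒∃[o]m+o≡n i<j
  ...   | p , i+p≡j = p , sym (iter-cancel (toℕ i) dx (iter-closed dx (suc p)) (begin
    iter f (toℕ i) x                  ≡⟨ encode-injective same ⟩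
    iter f (toℕ j) x                  ≡⟨ cong (λ k → iter f k x) (trans (sym i+p≡j) (sym (+-suc (toℕ i) p))) ⟩
    iter f (toℕ i + suc p) x          ≡⟨ iter-+ f (toℕ i) (suc p) x ⟩
    iter f (toℕ i) (iter f (suc p) x) ∎))
    where open ≡-Reasoning

  orbit-sym : ∀ {x y} → D x → ∀ k → iter f k x ≡ y → ∃ λ k′ → iter f k′ y ≡ x
  orbit-sym {x} dx k refl with periodic dx
  ... | p , period = k * p , (begin
    iter f (k * p) (iter f k x) ≡⟨ iter-+ f (k * p) k x ⟨
    iter f (k * p + k) x        ≡⟨ cong (λ m → iter f m x) (trans (+-comm (k * p) k) (sym (*-suc k p))) ⟩
    iter f (k * suc p) x        ≡⟨ iter-periodic f period k ⟩
    x                           ∎)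
    where open ≡-Reasoning

module CliqueSearch (_≟ᴬ_ : DecidableEquality A) {R : Rel A ℓ} (R? : Decidable R) (R-sym : Symmetric R) where

  open import Data.List.Membership.DecPropositional _≟ᴬ_ using () renaming (_∈?_ to _∈ᴬ?_)

  hasClique : ℕ → List A → Bool
  hasClique zero    _        = true
  hasClique (suc k) []       = false
  hasClique (suc k) (c ∷ cs) = hasClique k (filter (R? c) cs) ∨ hasClique (suc k) cs

  private
    remove-member : ∀ {c} → c ∈ xs → Unique xs → AllPairs R xs → xs ⊆ c ∷ cs →
                    ∃ λ ys → Unique ys × AllPairs R ys × ys ⊆ filter (R? c) cs × length xs ≡ suc (length ys)
    remove-member {cs = cs} {c = c} c∈xs uxs rxs sub with ∈-∃++ c∈xs
    ... | ys , zs , refl with allPairs-remove ≢-sym uxs | allPairs-remove R-sym rxs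
    ...   | c≢ , uyzs | Rc , ryzs = ys ++ zs , uyzs , ryzs , yzs⊆ , ↭-length (shift c ys zs)
      where
      yzs⊆ : ys ++ zs ⊆ filter (R? c) cs
      yzs⊆ p with sub (∈-insert p)
      ... | here refl = ⊥-elim (All.lookup c≢ p refl)
      ... | there q   = ∈-filter⁺ (R? c) q (All.lookup Rc p)

    remove-nonmember : ∀ {c} → c ∉ xs → xs ⊆ c ∷ cs → xs ⊆ cs
    remove-nonmember c∉xs sub p with sub p
    ... | here refl = ⊥-elim (c∉xs p)
    ... | there q   = q

  hasClique-complete : ∀ k cs → Unique xs → AllPairs R xs → xs ⊆ cs → k ≤ length xs → T (hasClique k cs)
  hasClique-complete zero    _  _ _ _ _ = _
  hasClique-complete (suc k) cs = found cs
    where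
    found : ∀ cs → Unique xs → AllPairs R xs → xs ⊆ cs → suc k ≤ length xs → T (hasClique (suc k) cs)
    found {xs = []}    []       _   _   _   ()
    found {xs = _ ∷ _} []       _   _   sub _    with () ← sub (here refl)
    found {xs = xs}    (c ∷ cs) uxs rxs sub k<xs with c ∈ᴬ? xs
    ... | no c∉xs  = Equivalence.from T-∨ (inj₂ (found cs uxs rxs (remove-nonmember c∉xs sub) k<xs))
    ... | yes c∈xs with remove-member c∈xs uxs rxs sub
    ...   | ys , uys , rys , ys⊆ , len = Equivalence.from T-∨
      (inj₁ (hasClique-complete k (filter (R? c) cs) uys rys ys⊆ (s≤s⁻¹ (subst (suc k ≤_) len k<xs))))

  clique-bound : ¬ T (hasClique (suc k) cs) → Unique xs → AllPairs R xs → xs ⊆ cs → length xs ≤ k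
  clique-bound {cs = cs} none uxs rxs sub = ≮⇒≥ λ k<xs → none (hasClique-complete _ cs uxs rxs sub k<xs)

adjacent-distinct : (G : Graph n) → adj G u v ≡ true → u ≢ v
adjacent-distinct {u = u} G uv refl = true≢false (trans (sym uv) (adj-irrefl G u))

walk-++ : Walk G u v → Walk G v w → Walk G u w
walk-++ here       q = q
walk-++ (step e p) q = step e (walk-++ p q)

walk-reverse : Walk G u v → Walk G v u
walk-reverse here = here
walk-reverse {G = G} {u = u} (step {w = w} e p) = walk-++ (walk-reverse p) (step (trans (adj-sym G w u) e) here)

connected-via : (r : Fin n) → (∀ u → Walk G u r) → Connected G
connected-via r to-r u v = walk-++ (to-r u) (walk-reverse (to-r v))

walkWithin : (G : Graph n) → ℕ → (u v : Fin n) → Maybe (Walk G u v)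
walkWithin G k u v with u ≟ v
walkWithin G k       u .u | yes refl = just here
walkWithin G zero    u v  | no _     = nothing
walkWithin G (suc k) u v  | no _     = foldr _<∣>_ nothing (map via (allFin _))
  where
  via : ∀ w → Maybe (Walk G u v)
  via w with adj G u w in e
  ... | true  = Maybe.map (step e) (walkWithin G k w v)
  ... | false = nothing

ReachableWithin : Graph n → Fin n → ℕ → Set
ReachableWithin G r k = ∀ u → T (is-just (walkWithin G k u r))

connected-within : (G : Graph n) (r : Fin n) (k : ℕ) → ReachableWithin G r k → Connected G
connected-within G r k found = connected-via r λ u → to-witness-T (walkWithin G k u r) (found u)

neighbours : Graph n → Fin n → List (Fin n)
neighbours G v = filter (λ w → adj G v w ≟ᵇ true) (allFin _)

degree : Graph n → Fin n → ℕ
degree G v = length (neighbours G v)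

degree-mono : (f : Fin n → Fin m) → Injective _≡_ _≡_ f →
              (∀ x y → adj G x y ≡ true → adj H (f x) (f y) ≡ true) →
              ∀ v → degree G v ≤ degree H (f v)
degree-mono {G = G} {H = H} f f-injective f-adj v =
  subst (_≤ degree H (f v)) (length-map f (neighbours G v))
    (length-unique-⊆ (Unique.map⁺ f-injective (Unique.filter⁺ (λ w → adj G v w ≟ᵇ true) (Unique.allFin⁺ _))) image⊆)
  where
  image⊆ : map f (neighbours G v) ⊆ neighbours H (f v)
  image⊆ p with ∈-map⁻ f p
  ... | x , x∈ , refl =
    ∈-filter⁺ _ (∈-allFin (f x)) (f-adj v x (proj₂ (∈-filter⁻ (λ w → adj G v w ≟ᵇ true) {xs = allFin _} x∈)))

≅-degree : ((φ , _) : G ≅ H) → ∀ v → degree H (Inverse.to φ v) ≡ degree G v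
≅-degree {G = G} {H = H} (φ , pres) v = ≤-antisym
  (subst (λ w → degree H (to v) ≤ degree G w) (strictlyInverseʳ v)
     (degree-mono {G = H} {H = G} from (Injection.injective (↔⇒↣ (↔-sym φ))) from-adj (to v)))
  (degree-mono {G = G} {H = H} to (Injection.injective (↔⇒↣ φ)) (λ x y e → trans (sym (pres x y)) e) v)
  where
  open Inverse φ
  from-adj : ∀ x y → adj H x y ≡ true → adj G (from x) (from y) ≡ true
  from-adj x y e = trans (pres (from x) (from y))
    (subst₂ (λ x′ y′ → adj H x′ y′ ≡ true) (sym (strictlyInverseˡ x)) (sym (strictlyInverseˡ y)) e)

≇-regular : (G H : Graph n) {d : ℕ} → (∀ v → degree H v ≡ d) → ∀ w → degree G w ≢ d → ¬ (G ≅ H)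
≇-regular G H regular w irregular iso@(φ , _) =
  irregular (trans (sym (≅-degree {G = G} {H = H} iso w)) (regular (Inverse.to φ w)))

Petersen-regular : ∀ v → degree Petersen v ≡ 3
Petersen-regular = from-yes (all? λ v → degree Petersen v ≟ℕ 3)

complement-Petersen-regular : ∀ v → degree (complement Petersen) v ≡ 6
complement-Petersen-regular = from-yes (all? λ v → degree (complement Petersen) v ≟ℕ 6)

Homogeneous : Graph n → Bool → List (Fin n) → Set
Homogeneous G b xs = Unique xs × AllPairs (λ x y → adj G x y ≡ b) xs

homogeneous? : (G : Graph n) (b : Bool) → Decidable₁ (Homogeneous G b)
homogeneous? G b xs = unique? xs ×-dec AllPairs.allPairs? (λ x y → adj G x y ≟ᵇ b) xs

adj-≟ : (G : Graph n) (b : Bool) → Decidable (λ x y → adj G x y ≡ b)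
adj-≟ G b x y = adj G x y ≟ᵇ b

adj-≡-sym : (G : Graph n) (b : Bool) → Symmetric (λ x y → adj G x y ≡ b)
adj-≡-sym G b {x} {y} xy = trans (adj-sym G y x) xy

module HomogeneousSearch {n : ℕ} (G : Graph n) (b : Bool) = CliqueSearch _≟_ (adj-≟ G b) (adj-≡-sym G b)

hasHomogeneous : Graph n → Bool → ℕ → Bool
hasHomogeneous G b k = HomogeneousSearch.hasClique G b k (allFin _)

largest-homogeneous : (G : Graph n) (b : Bool) {xs : List (Fin n)} →
  Homogeneous G b xs → ¬ T (hasHomogeneous G b (suc (length xs))) →
  (Σ _ λ ys → Homogeneous G b ys × length ys ≡ length xs) × (∀ ys → Homogeneous G b ys → length ys ≤ length xs)
largest-homogeneous G b {xs} homogeneous none =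
  (xs , homogeneous , refl) , λ ys (uys , hys) → clique-bound none uys hys (λ {y} _ → ∈-allFin y)
  where open HomogeneousSearch G b

triangle-girth : Homogeneous G true xs → 3 ≤ length xs → Girth G 3
triangle-girth {xs = []}         _ ()
triangle-girth {xs = _ ∷ []}     _ (s≤s ())
triangle-girth {xs = _ ∷ _ ∷ []} _ (s≤s (s≤s ()))
triangle-girth {G = G} {xs = x ∷ y ∷ z ∷ _}
  ((x≢y ∷ x≢z ∷ _) ∷ (y≢z ∷ _) ∷ _ , (xy ∷ xz ∷ _) ∷ (yz ∷ _) ∷ _) _ =
  (List.lookup triangle , lookup-injective triangle-unique , edges , trans (adj-sym G z x) xz) , at-least-3
  where
  triangle : List (Fin _)
  triangle = x ∷ y ∷ z ∷ []
  triangle-unique : Unique triangle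
  triangle-unique = (x≢y ∷ x≢z ∷ []) ∷ (y≢z ∷ []) ∷ [] ∷ []
  edges : ∀ i → adj G (List.lookup triangle (inject₁ i)) (List.lookup triangle (suc i)) ≡ true
  edges zero       = xy
  edges (suc zero) = yz
  at-least-3 : ∀ k → HasCycle G k → 3 ≤ k
  at-least-3 (suc (suc (suc _))) _ = s≤s (s≤s (s≤s z≤n))

IsInducedEmbedding : Graph m → Graph n → (Fin m → Fin n) → Set
IsInducedEmbedding H G f = Injective _≡_ _≡_ f × (∀ i j → adj H i j ≡ adj G (f i) (f j))

isInducedEmbedding? : (H : Graph m) (G : Graph n) (f : Fin m → Fin n) → Dec (IsInducedEmbedding H G f)
isInducedEmbedding? H G f =
  map′ (λ inj {i} {j} → inj i j) (λ inj i j → inj) (all? λ i → all? λ j → (f i ≟ f j) →-dec (i ≟ j))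
  ×-dec all? (λ i → all? λ j → adj H i j ≟ᵇ adj G (f i) (f j))

localComplements : Graph n → List (Fin n) → Graph n
localComplements G []       = G
localComplements G (v ∷ vs) = localComplements (G ⋆ v) vs

lcReach-localComplements : (G : Graph n) (vs : List (Fin n)) → LCReach G (localComplements G vs)
lcReach-localComplements G []       = lc-done
lcReach-localComplements G (v ∷ vs) = lc-step v (lcReach-localComplements (G ⋆ v) vs)

induced⇒vertexMinor : {G′ : Graph n} {f : Fin m → Fin n} →
                      LCReach G G′ → IsInducedEmbedding H G′ f → VertexMinor H G
induced⇒vertexMinor {G′ = G′} {f = f} lcs embedding = G′ , lcs , f , embedding

restrict : Graph n → (Fin m → Fin n) → Graph m
restrict G f = record
  { adj        = λ i j → adj G (f i) (f j)
  ; adj-sym    = λ i j → adj-sym G (f i) (f j)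
  ; adj-irrefl = λ i → adj-irrefl G (f i)
  }

subtree-unique : ∀ {s t : BTree n} → Subtree s t → Unique (leaves t) → Unique (leaves s)
subtree-unique sub-self      u = u
subtree-unique (sub-left p)  u = subtree-unique p (proj₁ (allPairs-++⁻ u))
subtree-unique (sub-right p) u = subtree-unique p (proj₂ (allPairs-++⁻ u))

cherry : (l r : BTree n) → ∃₂ λ x y → Subtree (node (leaf x) (leaf y)) (node l r)
cherry (leaf x)     (leaf y)     = x , y , sub-self
cherry (node l₁ l₂) r            = let x , y , p = cherry l₁ l₂ in x , y , sub-left p
cherry (leaf _)     (node r₁ r₂) = let x , y , p = cherry r₁ r₂ in x , y , sub-right p

-- A decomposition tree whose cuts carry k vertices, meant to have rows spanning the cut matrix.
data SpanTree (n k : ℕ) : Set where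
  leaf : Fin n → SpanTree n k
  node : Vec (Fin n) k → SpanTree n k → SpanTree n k → SpanTree n k

shape : SpanTree n k → BTree n
shape (leaf v)     = leaf v
shape (node _ l r) = node (shape l) (shape r)

spanningRows : SpanTree n k → Vec (Fin n) k
spanningRows (leaf v)        = replicate _ v
spanningRows (node rows _ _) = rows

coefficients : ∀ k → List (Vec Bool k)
coefficients zero    = [] ∷ []
coefficients (suc k) = List.cartesianProductWith _∷_ (false ∷ true ∷ []) (coefficients k)

SpannedBy : Graph n → List (Fin n) → Vec (Fin n) k → Set
SpannedBy {k = k} G X rows = All (λ x → Any (λ c → RowCombination c x) (coefficients k)) X
  where
  RowCombination : Vec Bool k → Fin _ → Set
  RowCombination c x = ∀ y → y ∉ X → adj G x y ≡ xorSum k (λ i → lookup c i ∧ adj G (lookup rows i) y)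

spannedBy? : (G : Graph n) (X : List (Fin n)) (rows : Vec (Fin n) k) → Dec (SpannedBy G X rows)
spannedBy? {k = k} G X rows = All.all? (λ x → Any.any? (λ c → all? λ y →
  ¬? (y ∈? X) →-dec (adj G x y ≟ᵇ xorSum k (λ i → lookup c i ∧ adj G (lookup rows i) y))) (coefficients k)) X

spannedBy⇒cutRank : ∀ {X} (rows : Vec (Fin n) k) → SpannedBy G X rows → CutRankAtMost G X k
spannedBy⇒cutRank {G = G} rows spanned =
  (λ i y → adj G (lookup rows i) y) ,
  λ x x∈X → let c , combination = satisfied (All.lookup spanned x∈X) in lookup c , combination

Certified : Graph n → SpanTree n k → Set
Certified G t@(leaf _)        = SpannedBy G (leaves (shape t)) (spanningRows t)
Certified G t@(node rows l r) = SpannedBy G (leaves (shape t)) rows × Certified G l × Certified G r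

certified? : (G : Graph n) (t : SpanTree n k) → Dec (Certified G t)
certified? G t@(leaf _)        = spannedBy? G (leaves (shape t)) (spanningRows t)
certified? G t@(node rows l r) = spannedBy? G (leaves (shape t)) rows ×-dec certified? G l ×-dec certified? G r

certified⇒cutRank : (t : SpanTree n k) → Certified G t → ∀ s → Subtree s (shape t) → CutRankAtMost G (leaves s) k
certified⇒cutRank {G = G} t@(leaf _)      spanned       _ sub-self      = spannedBy⇒cutRank {G = G} (spanningRows t) spanned
certified⇒cutRank {G = G} (node rows _ _) (spanned , _) _ sub-self      = spannedBy⇒cutRank {G = G} rows spanned
certified⇒cutRank         (node _ l _)    (_ , cl , _)  s (sub-left p)  = certified⇒cutRank l cl s p
certified⇒cutRank         (node _ _ r)    (_ , _ , cr)  s (sub-right p) = certified⇒cutRank r cr s p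

isRankDecomposition? : (t : BTree n) → Dec (IsRankDecomposition t)
isRankDecomposition? t = unique? (leaves t) ×-dec all? (λ v → v ∈? leaves t)

rankWidthAtMost : (t : SpanTree n k) → IsRankDecomposition (shape t) → Certified G t → RankWidthAtMost G k
rankWidthAtMost t decomposition certified = shape t , decomposition , certified⇒cutRank t certified

cutRank-suc : ∀ {X} → CutRankAtMost G X k → CutRankAtMost G X (suc k)
cutRank-suc (basis , spans) =
  (λ { zero _ → false ; (suc i) → basis i }) ,
  λ x x∈X → let c , combination = spans x x∈X in (λ { zero → false ; (suc i) → c i }) , combination

rank-one-minor : ∀ a c p q → ((a ∧ p) xor false) ∧ ((c ∧ q) xor false) ≡ ((a ∧ q) xor false) ∧ ((c ∧ p) xor false)
rank-one-minor true  true  p q = ∧-comm (p xor false) (q xor false)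
rank-one-minor true  false p q = trans (∧-zeroʳ (p xor false)) (sym (∧-zeroʳ (q xor false)))
rank-one-minor false c     p q = refl

cutRank₁-minor : ∀ {X} → CutRankAtMost G X 1 → x ∈ X → y ∈ X → z ∉ X → w ∉ X →
                 adj G x z ∧ adj G y w ≡ adj G x w ∧ adj G y z
cutRank₁-minor {G = G} {x = x} {y = y} {z = z} {w = w} (basis , spans) x∈X y∈X z∉X w∉X =
  let cx , x-row = spans x x∈X ; cy , y-row = spans y y∈X in begin
  adj G x z ∧ adj G y w  ≡⟨ cong₂ _∧_ (x-row z z∉X) (y-row w w∉X) ⟩
  _                      ≡⟨ rank-one-minor (cx zero) (cy zero) (basis zero z) (basis zero w) ⟩
  _                      ≡⟨ cong₂ _∧_ (x-row w w∉X) (y-row z z∉X) ⟨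
  adj G x w ∧ adj G y z  ∎
  where open ≡-Reasoning

NonsingularMinor : Graph n → Fin n → Fin n → Set
NonsingularMinor G x y =
  ∃₂ λ z w → (z ≢ x × z ≢ y) × (w ≢ x × w ≢ y) × (adj G x z ∧ adj G y w ≢ adj G x w ∧ adj G y z)

AllPairsNonsingular : Graph n → Set
AllPairsNonsingular G = ∀ x y → x ≢ y → NonsingularMinor G x y

allPairsNonsingular? : (G : Graph n) → Dec (AllPairsNonsingular G)
allPairsNonsingular? G = all? λ x → all? λ y → ¬? (x ≟ y) →-dec
  (any? λ z → any? λ w → (¬? (z ≟ x) ×-dec ¬? (z ≟ y)) ×-dec (¬? (w ≟ x) ×-dec ¬? (w ≟ y))
                         ×-dec ¬? (adj G x z ∧ adj G y w ≟ᵇ adj G x w ∧ adj G y z))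

¬rankWidth≤1 : (G : Graph (suc (suc n))) → AllPairsNonsingular G → ¬ RankWidthAtMost G 1
¬rankWidth≤1 G independent (leaf v , (_ , covers) , _) with covers zero | covers (suc zero)
... | here refl | here ()
¬rankWidth≤1 G independent (node l r , (unique , _) , cuts) with cherry l r
... | x , y , sub with subtree-unique sub unique
...   | (x≢y ∷ []) ∷ _ with independent x y x≢y
...     | z , w , (z≢x , z≢y) , (w≢x , w≢y) , nonsingular =
  nonsingular (cutRank₁-minor {G = G} (cuts _ sub) (here refl) (there (here refl)) (outside z≢x z≢y) (outside w≢x w≢y))
  where
  outside : ∀ {v} → v ≢ x → v ≢ y → v ∉ x ∷ y ∷ []
  outside v≢x _   (here p)         = v≢x p
  outside _   v≢y (there (here p)) = v≢y p

rankWidth≥2 : (G : Graph (suc (suc n))) → AllPairsNonsingular G → ∀ j → RankWidthAtMost G j → 2 ≤ j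
rankWidth≥2 G independent zero          (t , d , cuts) =
  ⊥-elim (¬rankWidth≤1 G independent (t , d , λ s p → cutRank-suc {G = G} (cuts s p)))
rankWidth≥2 G independent (suc zero)    width₁ = ⊥-elim (¬rankWidth≤1 G independent width₁)
rankWidth≥2 G _           (suc (suc j)) _      = s≤s (s≤s z≤n)

circle-induced : ∀ {f : Fin m → Fin n} → IsCircleGraph G → IsInducedEmbedding H G f → IsCircleGraph H
circle-induced {f = f} (a , b , a<b , distinct , crossing) (f-injective , f-adj) =
  a ∘ f , b ∘ f , a<b ∘ f , (λ u v u≢v → distinct (f u) (f v) (u≢v ∘ f-injective)) ,
  λ u v u≢v → let cross , uncross = crossing (f u) (f v) (u≢v ∘ f-injective)
              in cross ∘ trans (sym (f-adj u v)) , trans (f-adj u v) ∘ uncross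

-- For pairwise distinct endpoints, the chords {x, y} and {z, w} cross iff exactly one of z, w lies
-- between x and y; as a sum of the four comparisons over GF(2) this is invariant under swapping the
-- ends of a chord and changes by a product term when an arc is reversed.
between : ℕ → ℕ → ℕ → Bool
between x y t = (x <ᵇ t) xor (y <ᵇ t)

crossesᵇ : ℕ → ℕ → ℕ → ℕ → Bool
crossesᵇ x y z w = between x y z xor between x y w

between-inside : x < t → t < y → between x y t ≡ true
between-inside x<t t<y rewrite <⇒<ᵇ≡true x<t | ≥⇒<ᵇ≡false (<⇒≤ t<y) = refl

between-below : t < x → x < y → between x y t ≡ false
between-below t<x x<y rewrite ≥⇒<ᵇ≡false (<⇒≤ t<x) | ≥⇒<ᵇ≡false (<⇒≤ (<-trans t<x x<y)) = refl

between-above : x < y → y < t → between x y t ≡ false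
between-above x<y y<t rewrite <⇒<ᵇ≡true (<-trans x<y y<t) | <⇒<ᵇ≡true y<t = refl

between-true⇒ : x < y → t ≢ y → between x y t ≡ true → x < t × t < y
between-true⇒ {x = x} {y = y} {t = t} x<y t≢y inside with x <ᵇ t in x<t | y <ᵇ t in y<t
... | true  | false = <ᵇ≡true⇒< {x} {t} x<t , ≤∧≢⇒< (<ᵇ≡false⇒≥ {y} {t} y<t) t≢y
... | false | true  = ⊥-elim (<⇒≱ (<-trans x<y (<ᵇ≡true⇒< {y} {t} y<t)) (<ᵇ≡false⇒≥ {x} {t} x<t))

between-false⇒ : t ≢ x → between x y t ≡ false → t < x ⊎ y < t
between-false⇒ {t = t} {x = x} {y = y} t≢x outside with x <ᵇ t in x<t | y <ᵇ t in y<t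
... | true  | true  = inj₂ (<ᵇ≡true⇒< {y} {t} y<t)
... | false | false = inj₁ (≤∧≢⇒< (<ᵇ≡false⇒≥ {x} {t} x<t) t≢x)

crosses⇒crossesᵇ : ChordsCross x y z w → crossesᵇ x y z w ≡ true
crosses⇒crossesᵇ (inj₁ (x<z , z<y , y<w)) rewrite between-inside x<z z<y | between-above (<-trans x<z z<y) y<w = refl
crosses⇒crossesᵇ (inj₂ (z<x , x<w , w<y)) rewrite between-below z<x (<-trans x<w w<y) | between-inside x<w w<y = refl

crossesᵇ⇒crosses : x < y → z < w → x ≢ z → x ≢ w → y ≢ z → y ≢ w →
                   crossesᵇ x y z w ≡ true → ChordsCross x y z w
crossesᵇ⇒crosses {x = x} {y = y} {z = z} {w = w} x<y z<w x≢z x≢w y≢z y≢w crossing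
  with between x y z in z-inside | between x y w in w-inside
... | true  | false with between-true⇒ x<y (≢-sym y≢z) z-inside | between-false⇒ (≢-sym x≢w) w-inside
...   | x<z , z<y | inj₁ w<x = ⊥-elim (<-asym (<-trans x<z z<w) w<x)
...   | x<z , z<y | inj₂ y<w = inj₁ (x<z , z<y , y<w)
crossesᵇ⇒crosses {x = x} {y = y} {z = z} {w = w} x<y z<w x≢z x≢w y≢z y≢w crossing | false | true
  with between-false⇒ (≢-sym x≢z) z-inside | between-true⇒ x<y (≢-sym y≢w) w-inside
...   | inj₁ z<x | x<w , w<y = inj₂ (z<x , x<w , w<y)
...   | inj₂ y<z | x<w , w<y = ⊥-elim (<-asym (<-trans y<z z<w) w<y)

crossesᵇ-swapˡ : ∀ x y z w → crossesᵇ x y z w ≡ crossesᵇ y x z w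
crossesᵇ-swapˡ x y z w = cong₂ _xor_ (xor-comm (x <ᵇ z) (y <ᵇ z)) (xor-comm (x <ᵇ w) (y <ᵇ w))

crossesᵇ-swapʳ : ∀ x y z w → crossesᵇ x y z w ≡ crossesᵇ x y w z
crossesᵇ-swapʳ x y z w = xor-comm (between x y z) (between x y w)

record ChordDiagram (G : Graph n) : Set where
  field
    end           : Fin n → Bool → ℕ
    end-injective : ∀ {u s w t} → end u s ≡ end w t → u ≡ w × s ≡ t
    adj-crosses   : ∀ {u w} → u ≢ w → adj G u w ≡ crossesᵇ (end u false) (end u true) (end w false) (end w true)

circle⇒diagram : {G : Graph n} → IsCircleGraph G → ChordDiagram G
circle⇒diagram {G = G} (a , b , a<b , distinct , crossing) = record
  { end           = end
  ; end-injective = end-injective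
  ; adj-crosses   = adj-crosses
  }
  where
  end : Fin _ → Bool → ℕ
  end u false = a u
  end u true  = b u

  end-injective : ∀ {u s w t} → end u s ≡ end w t → u ≡ w × s ≡ t
  end-injective {u} {s} {w} {t} same with u ≟ w
  end-injective {u} {false} {.u} {false} same | yes refl = refl , refl
  end-injective {u} {false} {.u} {true}  same | yes refl = ⊥-elim (<-irrefl same (a<b u))
  end-injective {u} {true}  {.u} {false} same | yes refl = ⊥-elim (<-irrefl (sym same) (a<b u))
  end-injective {u} {true}  {.u} {true}  same | yes refl = refl , refl
  end-injective {u} {false} {w} {false} same | no u≢w = ⊥-elim (proj₁ (distinct u w u≢w) same)
  end-injective {u} {false} {w} {true}  same | no u≢w = ⊥-elim (proj₁ (proj₂ (distinct u w u≢w)) same)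
  end-injective {u} {true}  {w} {false} same | no u≢w = ⊥-elim (proj₁ (proj₂ (distinct w u (u≢w ∘ sym))) (sym same))
  end-injective {u} {true}  {w} {true}  same | no u≢w = ⊥-elim (proj₂ (proj₂ (distinct u w u≢w)) same)

  adj-crosses : ∀ {u w} → u ≢ w → adj G u w ≡ crossesᵇ (a u) (b u) (a w) (b w)
  adj-crosses {u} {w} u≢w with adj G u w in uw | crossesᵇ (a u) (b u) (a w) (b w) in cross
  ... | true  | true  = refl
  ... | false | false = refl
  ... | true  | false = ⊥-elim (true≢false (trans (sym (crosses⇒crossesᵇ (proj₁ (crossing u w u≢w) uw))) cross))
  ... | false | true  =
    let a≢a , a≢b , b≢b = distinct u w u≢w
        b≢a = λ e → proj₁ (proj₂ (distinct w u (u≢w ∘ sym))) (sym e)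
        chords-cross = crossesᵇ⇒crosses (a<b u) (a<b w) a≢a a≢b b≢a b≢b cross
    in ⊥-elim (true≢false (trans (sym (proj₂ (crossing u w u≢w) chords-cross)) uw))

diagram⇒circle : {G : Graph n} → ChordDiagram G → IsCircleGraph G
diagram⇒circle {G = G} D = a , b , a<b , distinct , crossing
  where
  open ChordDiagram D
  a b : Fin _ → ℕ
  a u = end u false ⊓ end u true
  b u = end u false ⊔ end u true

  Oriented : Fin _ → Set
  Oriented u = (a u ≡ end u false × b u ≡ end u true) ⊎ (a u ≡ end u true × b u ≡ end u false)

  orientation : ∀ u → Oriented u
  orientation u with ≤-total (end u false) (end u true)
  ... | inj₁ f≤t = inj₁ (m≤n⇒m⊓n≡m f≤t , m≤n⇒m⊔n≡n f≤t)
  ... | inj₂ t≤f = inj₂ (m≥n⇒m⊓n≡n t≤f , m≥n⇒m⊔n≡m t≤f)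

  a-end : ∀ u → ∃ λ s → a u ≡ end u s
  a-end u with orientation u
  ... | inj₁ (a≡ , _) = false , a≡
  ... | inj₂ (a≡ , _) = true , a≡

  b-end : ∀ u → ∃ λ s → b u ≡ end u s
  b-end u with orientation u
  ... | inj₁ (_ , b≡) = true , b≡
  ... | inj₂ (_ , b≡) = false , b≡

  a<b : ∀ u → a u < b u
  a<b u = ≤∧≢⇒< (m⊓n≤m⊔n (end u false) (end u true)) a≢b
    where
    a≢b : a u ≢ b u
    a≢b same with orientation u
    ... | inj₁ (a≡ , b≡) =
      ≢-sym true≢false (proj₂ (end-injective {u} {false} {u} {true} (trans (sym a≡) (trans same b≡))))
    ... | inj₂ (a≡ , b≡) =
      true≢false (proj₂ (end-injective {u} {true} {u} {false} (trans (sym a≡) (trans same b≡))))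

  apart : ∀ {u w x y} → u ≢ w → (∃ λ s → x ≡ end u s) → (∃ λ t → y ≡ end w t) → x ≢ y
  apart u≢w (_ , x≡) (_ , y≡) same = u≢w (proj₁ (end-injective (trans (sym x≡) (trans same y≡))))

  distinct : ∀ u w → u ≢ w → (a u ≢ a w) × (a u ≢ b w) × (b u ≢ b w)
  distinct u w u≢w = apart u≢w (a-end u) (a-end w) , apart u≢w (a-end u) (b-end w) , apart u≢w (b-end u) (b-end w)

  oriented-crosses : ∀ u w → crossesᵇ (a u) (b u) (a w) (b w) ≡
                             crossesᵇ (end u false) (end u true) (end w false) (end w true)
  oriented-crosses u w with orientation u | orientation w
  ... | inj₁ (au , bu) | inj₁ (aw , bw) rewrite au | bu | aw | bw = refl
  ... | inj₁ (au , bu) | inj₂ (aw , bw) rewrite au | bu | aw | bw =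
    crossesᵇ-swapʳ (end u false) (end u true) (end w true) (end w false)
  ... | inj₂ (au , bu) | inj₁ (aw , bw) rewrite au | bu | aw | bw =
    crossesᵇ-swapˡ (end u true) (end u false) (end w false) (end w true)
  ... | inj₂ (au , bu) | inj₂ (aw , bw) rewrite au | bu | aw | bw =
    trans (crossesᵇ-swapˡ (end u true) (end u false) (end w true) (end w false))
          (crossesᵇ-swapʳ (end u false) (end u true) (end w true) (end w false))

  crossing : ∀ u w → u ≢ w → (adj G u w ≡ true → ChordsCross (a u) (b u) (a w) (b w))
                             × (ChordsCross (a u) (b u) (a w) (b w) → adj G u w ≡ true)
  crossing u w u≢w =
    let a≢a , a≢b , b≢b = distinct u w u≢w
        b≢a = λ e → apart (u≢w ∘ sym) (a-end w) (b-end u) (sym e)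
    in (λ uw → crossesᵇ⇒crosses (a<b u) (a<b w) a≢a a≢b b≢a b≢b
                 (trans (oriented-crosses u w) (trans (sym (adj-crosses u≢w)) uw))) ,
       (λ cross → trans (adj-crosses u≢w) (trans (sym (oriented-crosses u w)) (crosses⇒crossesᵇ cross)))

-- Local complementation at a vertex with chord (A, B) is realised by reversing the arc from A to B.
module Reflection (A B : ℕ) (A<B : A < B) where

  inside : ℕ → Bool
  inside t = (A <ᵇ t) ∧ (t <ᵇ B)

  reflect : ℕ → ℕ
  reflect t = if inside t then A + B ∸ t else t

  inside⇒ : inside t ≡ true → A < t × t < B
  inside⇒ {t} inside-t with A <ᵇ t in A<t | t <ᵇ B in t<B
  ... | true | true = <ᵇ≡true⇒< {A} {t} A<t , <ᵇ≡true⇒< {t} {B} t<B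

  outside⇒ : inside t ≡ false → t ≤ A ⊎ B ≤ t
  outside⇒ {t} outside with A <ᵇ t in A<t | t <ᵇ B in t<B
  ... | false | _     = inj₁ (<ᵇ≡false⇒≥ {A} {t} A<t)
  ... | true  | false = inj₂ (<ᵇ≡false⇒≥ {t} {B} t<B)

  inside⇐ : A < t → t < B → inside t ≡ true
  inside⇐ A<t t<B rewrite <⇒<ᵇ≡true A<t | <⇒<ᵇ≡true t<B = refl

  mirror-inside : A < t → t < B → A < A + B ∸ t × A + B ∸ t < B
  mirror-inside {t} A<t t<B rewrite +-∸-assoc A (<⇒≤ t<B) =
    m<m+n A (m<n⇒0<n∸m t<B) , subst (A + (B ∸ t) <_) (m+[n∸m]≡n (<⇒≤ t<B)) (+-monoˡ-< (B ∸ t) A<t)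

  reflect-involutive : ∀ t → reflect (reflect t) ≡ t
  reflect-involutive t with inside t in inside-t
  ... | false rewrite inside-t = refl
  ... | true with inside⇒ inside-t
  ...   | A<t , t<B with mirror-inside A<t t<B
  ...     | A<t′ , t′<B rewrite inside⇐ A<t′ t′<B = m∸[m∸n]≡n (≤-trans (<⇒≤ t<B) (m≤n+m B A))

  reflect-injective : reflect x ≡ reflect y → x ≡ y
  reflect-injective {x} {y} same = trans (sym (reflect-involutive x)) (trans (cong reflect same) (reflect-involutive y))

  reflect-< : x ≢ y → (reflect x <ᵇ reflect y) ≡ (x <ᵇ y) xor (inside x ∧ inside y)
  reflect-< {x} {y} x≢y with inside x in inside-x | inside y in inside-y
  ... | false | false = sym (xor-identityʳ (x <ᵇ y))
  ... | true  | true  with inside⇒ inside-x | inside⇒ inside-y | <-cmp x y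
  ...   | _ | (_ , y<B) | tri< x<y _ _ rewrite <⇒<ᵇ≡true x<y =
    ≥⇒<ᵇ≡false (<⇒≤ (∸-monoʳ-< x<y (≤-trans (<⇒≤ y<B) (m≤n+m B A))))
  ...   | _ | _         | tri≈ _ x≡y _ = ⊥-elim (x≢y x≡y)
  ...   | (_ , x<B) | _ | tri> _ _ y<x rewrite ≥⇒<ᵇ≡false (<⇒≤ y<x) =
    <⇒<ᵇ≡true (∸-monoʳ-< y<x (≤-trans (<⇒≤ x<B) (m≤n+m B A)))
  reflect-< {x} {y} x≢y | true | false with inside⇒ inside-x | outside⇒ inside-y
  ...   | (A<x , x<B) | inj₁ y≤A rewrite ≥⇒<ᵇ≡false (≤-trans y≤A (<⇒≤ A<x)) =
    trans (≥⇒<ᵇ≡false (≤-trans y≤A (<⇒≤ (proj₁ (mirror-inside A<x x<B))))) (sym (∧-zeroʳ true))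
  ...   | (A<x , x<B) | inj₂ B≤y rewrite <⇒<ᵇ≡true (<-≤-trans x<B B≤y) =
    <⇒<ᵇ≡true (<-≤-trans (proj₂ (mirror-inside A<x x<B)) B≤y)
  reflect-< {x} {y} x≢y | false | true with outside⇒ inside-x | inside⇒ inside-y
  ...   | inj₁ x≤A | (A<y , y<B) rewrite <⇒<ᵇ≡true (≤-<-trans x≤A A<y) =
    <⇒<ᵇ≡true (≤-<-trans x≤A (proj₁ (mirror-inside A<y y<B)))
  ...   | inj₂ B≤x | (A<y , y<B) rewrite ≥⇒<ᵇ≡false (≤-trans (<⇒≤ y<B) B≤x) =
    ≥⇒<ᵇ≡false (≤-trans (<⇒≤ (proj₂ (mirror-inside A<y y<B))) B≤x)

  between≡inside : t ≢ A → t ≢ B → between A B t ≡ inside t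
  between≡inside {t} t≢A t≢B with A <ᵇ t in A<t | B <ᵇ t in B<t | t <ᵇ B in t<B
  ... | true  | true  | false = refl
  ... | true  | true  | true  = ⊥-elim (<-asym (<ᵇ≡true⇒< {B} {t} B<t) (<ᵇ≡true⇒< {t} {B} t<B))
  ... | true  | false | true  = refl
  ... | true  | false | false = ⊥-elim (t≢B (≤-antisym (<ᵇ≡false⇒≥ {B} {t} B<t) (<ᵇ≡false⇒≥ {t} {B} t<B)))
  ... | false | false | _     = refl
  ... | false | true  | _     = ⊥-elim (<⇒≱ (<-trans A<B (<ᵇ≡true⇒< {B} {t} B<t)) (<ᵇ≡false⇒≥ {A} {t} A<t))

  reflect-crossesᵇ : x ≢ z → x ≢ w → y ≢ z → y ≢ w →
    crossesᵇ (reflect x) (reflect y) (reflect z) (reflect w) ≡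
    crossesᵇ x y z w xor ((inside x xor inside y) ∧ (inside z xor inside w))
  reflect-crossesᵇ {x} {z} {w} {y} x≢z x≢w y≢z y≢w = begin
    crossesᵇ (reflect x) (reflect y) (reflect z) (reflect w)
      ≡⟨ cong₂ _xor_ (cong₂ _xor_ (reflect-< x≢z) (reflect-< y≢z)) (cong₂ _xor_ (reflect-< x≢w) (reflect-< y≢w)) ⟩
    (((x <ᵇ z) xor (inside x ∧ inside z)) xor ((y <ᵇ z) xor (inside y ∧ inside z))) xor
    (((x <ᵇ w) xor (inside x ∧ inside w)) xor ((y <ᵇ w) xor (inside y ∧ inside w)))
      ≡⟨ cong₂ _xor_ (xor-interchange (x <ᵇ z) _ (y <ᵇ z) _) (xor-interchange (x <ᵇ w) _ (y <ᵇ w) _) ⟩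
    (between x y z xor ((inside x ∧ inside z) xor (inside y ∧ inside z))) xor
    (between x y w xor ((inside x ∧ inside w) xor (inside y ∧ inside w)))
      ≡⟨ xor-interchange (between x y z) _ (between x y w) _ ⟩
    crossesᵇ x y z w xor (((inside x ∧ inside z) xor (inside y ∧ inside z)) xor ((inside x ∧ inside w) xor (inside y ∧ inside w)))
      ≡⟨ cong (crossesᵇ x y z w xor_) (cong₂ _xor_ (∧-distribʳ-xor (inside z) (inside x) (inside y))
                                                   (∧-distribʳ-xor (inside w) (inside x) (inside y))) ⟨
    crossesᵇ x y z w xor (((inside x xor inside y) ∧ inside z) xor ((inside x xor inside y) ∧ inside w))
      ≡⟨ cong (crossesᵇ x y z w xor_) (∧-distribˡ-xor (inside x xor inside y) (inside z) (inside w)) ⟨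
    crossesᵇ x y z w xor ((inside x xor inside y) ∧ (inside z xor inside w)) ∎
    where open ≡-Reasoning

circle-⋆ : {G : Graph n} → IsCircleGraph G → ∀ v → IsCircleGraph (G ⋆ v)
circle-⋆ {G = G} circle@(a , b , a<b , _ , _) v = diagram⇒circle {G = G ⋆ v} (record
  { end           = λ u s → reflect (end u s)
  ; end-injective = end-injective ∘ reflect-injective
  ; adj-crosses   = adj-crosses′
  })
  where
  open ChordDiagram (circle⇒diagram {G = G} circle)
  open Reflection (a v) (b v) (a<b v)

  parity : ∀ u → adj G v u ≡ inside (end u false) xor inside (end u true)
  parity u with v ≟ u
  ... | yes refl rewrite ≥⇒<ᵇ≡false (≤-refl {a v}) | ≥⇒<ᵇ≡false (≤-refl {b v}) =
    trans (adj-irrefl G v) (sym (∧-zeroʳ (a v <ᵇ b v)))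
  ... | no v≢u = trans (adj-crosses v≢u) (cong₂ _xor_ (between≡inside (apart false false) (apart false true))
                                                     (between≡inside (apart true false) (apart true true)))
    where
    apart : ∀ s t → end u s ≢ end v t
    apart s t same = v≢u (sym (proj₁ (end-injective {u} {s} {v} {t} same)))

  adj-crosses′ : ∀ {u w} → u ≢ w → adj (G ⋆ v) u w ≡
                 crossesᵇ (reflect (end u false)) (reflect (end u true)) (reflect (end w false)) (reflect (end w true))
  adj-crosses′ {u} {w} u≢w = begin
    adj G u w xor ((adj G v u ∧ adj G v w) ∧ not ⌊ u ≟ w ⌋)
      ≡⟨ cong₂ (λ c d → c xor ((adj G v u ∧ adj G v w) ∧ not d)) (adj-crosses u≢w) (⌊≟⌋-false u≢w) ⟩
    crossesᵇ (end u false) (end u true) (end w false) (end w true) xor ((adj G v u ∧ adj G v w) ∧ true)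
      ≡⟨ cong (crossesᵇ (end u false) (end u true) (end w false) (end w true) xor_)
              (trans (∧-identityʳ _) (cong₂ _∧_ (parity u) (parity w))) ⟩
    crossesᵇ (end u false) (end u true) (end w false) (end w true) xor
      ((inside (end u false) xor inside (end u true)) ∧ (inside (end w false) xor inside (end w true)))
      ≡⟨ reflect-crossesᵇ (apart false false) (apart false true) (apart true false) (apart true true) ⟨
    crossesᵇ (reflect (end u false)) (reflect (end u true)) (reflect (end w false)) (reflect (end w true)) ∎
    where
    open ≡-Reasoning
    apart : ∀ s t → end u s ≢ end w t
    apart s t same = u≢w (proj₁ (end-injective {u} {s} {w} {t} same))

circle-lc : {G H : Graph n} → LCReach G H → IsCircleGraph G → IsCircleGraph H
circle-lc lc-done         circle = circle
circle-lc {G = G} (lc-step v lcs) circle = circle-lc lcs (circle-⋆ {G = G} circle v)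

-- Adjacency is agreement of the two orders: the complement of the usual convention, which
-- describes the same (complement-closed) class of permutation graphs.
record PermutationModel (H : Graph m) : Set where
  field
    inner outer     : Fin m → ℕ
    inner-injective : Injective _≡_ _≡_ inner
    agree           : ∀ {i j} → adj H i j ≡ true → inner i < inner j → outer i < outer j
    disagree        : ∀ {i j} → adj H i j ≡ false → i ≢ j → inner i < inner j → outer j < outer i

module _ {H : Graph m} (M : PermutationModel H) where
  open PermutationModel M

  private
    ¬monotone-path : ∀ {i j k} → adj H i j ≡ true → adj H j k ≡ true → adj H i k ≡ false → i ≢ k →
                     inner i < inner j → inner j < inner k → ⊥
    ¬monotone-path ij jk ik i≢k i<j j<k =
      <-asym (disagree ik i≢k (<-trans i<j j<k)) (<-trans (agree ij i<j) (agree jk j<k))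

  induced-path-turns : ∀ {i j k} → adj H i j ≡ true → adj H j k ≡ true → adj H i k ≡ false → i ≢ k →
                       (inner i <ᵇ inner j) ≢ (inner j <ᵇ inner k)
  induced-path-turns {i} {j} {k} ij jk ik i≢k same with inner i <ᵇ inner j in i<j | inner j <ᵇ inner k in j<k
  ... | true  | true  = ¬monotone-path ij jk ik i≢k (<ᵇ≡true⇒< i<j) (<ᵇ≡true⇒< j<k)
  ... | true  | false = true≢false same
  ... | false | true  = true≢false (sym same)
  ... | false | false = ¬monotone-path (trans (adj-sym H k j) jk) (trans (adj-sym H j i) ij) (trans (adj-sym H k i) ik)
                          (≢-sym i≢k) (reversed (adjacent-distinct H jk) j<k) (reversed (adjacent-distinct H ij) i<j)
    where
    reversed : ∀ {x y} → x ≢ y → (inner x <ᵇ inner y) ≡ false → inner y < inner x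
    reversed x≢y x≮y = ≤∧≢⇒< (<ᵇ≡false⇒≥ x≮y) (λ e → x≢y (inner-injective (sym e)))

¬alternating₅ : ∀ {a b c d e : Bool} → a ≢ b → b ≢ c → c ≢ d → d ≢ e → e ≢ a → ⊥
¬alternating₅ {a} {b} {c} {d} {e} a≢b b≢c c≢d d≢e e≢a = not-¬ refl (begin
  a           ≡⟨ ¬-not a≢b ⟩
  not b       ≡⟨ cong not (¬-not b≢c) ⟩
  not (not c) ≡⟨ not-involutive c ⟩
  c           ≡⟨ ¬-not c≢d ⟩
  not d       ≡⟨ cong not (¬-not d≢e) ⟩
  not (not e) ≡⟨ not-involutive e ⟩
  e           ≡⟨ ¬-not e≢a ⟩
  not a       ∎)
  where open ≡-Reasoning

rim-not-permutation : ¬ PermutationModel (restrict W5 suc)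
rim-not-permutation M = ¬alternating₅
  (induced-path-turns M {# 0} {# 1} {# 2} refl refl refl (λ ()))
  (induced-path-turns M {# 1} {# 2} {# 3} refl refl refl (λ ()))
  (induced-path-turns M {# 2} {# 3} {# 4} refl refl refl (λ ()))
  (induced-path-turns M {# 3} {# 4} {# 0} refl refl refl (λ ()))
  (induced-path-turns M {# 4} {# 0} {# 1} refl refl refl (λ ()))

-- A chord crossing the hub chord (A, B) has an inner endpoint in (A, B) and an outer one; reading
-- the circle from B, an outer endpoint lying before A comes last, hence the shift by K.
module HubChord (A B K : ℕ) where

  inner outer : ∀ {x y} → ChordsCross A B x y → ℕ
  inner {x = x} (inj₁ _) = x
  inner {y = y} (inj₂ _) = y
  outer {y = y} (inj₁ _) = y
  outer {x = x} (inj₂ _) = K + x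

  crossing-agree : ∀ {x y z w} (h₁ : ChordsCross A B x y) (h₂ : ChordsCross A B z w) → y < K →
                   ChordsCross x y z w → inner h₁ < inner h₂ → outer h₁ < outer h₂
  crossing-agree (inj₁ _) (inj₁ _) _ (inj₁ (_ , _ , y<w)) _   = y<w
  crossing-agree (inj₁ _) (inj₁ _) _ (inj₂ (z<x , _ , _)) x<z = ⊥-elim (<-asym x<z z<x)
  crossing-agree {z = z} (inj₁ _) (inj₂ _) y<K _ _ = <-≤-trans y<K (m≤m+n _ z)
  crossing-agree (inj₂ _) (inj₁ _) _ (inj₁ (_ , z<y , _)) y<z = ⊥-elim (<-asym y<z z<y)
  crossing-agree (inj₂ (x<A , _ , _)) (inj₁ (A<z , _ , _)) _ (inj₂ (z<x , _ , _)) _ = ⊥-elim (<-asym (<-trans x<A A<z) z<x)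
  crossing-agree (inj₂ _) (inj₂ _) _ (inj₁ (x<z , _ , _)) _   = +-monoʳ-< K x<z
  crossing-agree (inj₂ _) (inj₂ _) _ (inj₂ (_ , _ , w<y)) y<w = ⊥-elim (<-asym y<w w<y)

  crossing-disagree : ∀ {x y z w} (h₁ : ChordsCross A B x y) (h₂ : ChordsCross A B z w) → w < K → x ≢ z → y ≢ w →
                      ¬ ChordsCross x y z w → inner h₁ < inner h₂ → outer h₂ < outer h₁
  crossing-disagree {y = y} {w = w} (inj₁ (_ , _ , B<y)) (inj₁ (_ , z<B , _)) _ _ y≢w ¬cross x<z with <-cmp w y
  ... | tri< w<y _ _ = w<y
  ... | tri≈ _ w≡y _ = ⊥-elim (y≢w (sym w≡y))
  ... | tri> _ _ y<w = ⊥-elim (¬cross (inj₁ (x<z , <-trans z<B B<y , y<w)))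
  crossing-disagree (inj₁ (A<x , _ , B<y)) (inj₂ (z<A , _ , w<B)) _ _ _ ¬cross x<w =
    ⊥-elim (¬cross (inj₂ (<-trans z<A A<x , x<w , <-trans w<B B<y)))
  crossing-disagree {x = x} (inj₂ _) (inj₁ _) w<K _ _ _ _ = <-≤-trans w<K (m≤m+n _ x)
  crossing-disagree {x = x} {z = z} (inj₂ (_ , A<y , _)) (inj₂ (z<A , _ , _)) _ x≢z _ ¬cross y<w with <-cmp z x
  ... | tri< z<x _ _ = +-monoʳ-< K z<x
  ... | tri≈ _ z≡x _ = ⊥-elim (x≢z (sym z≡x))
  ... | tri> _ _ x<z = ⊥-elim (¬cross (inj₁ (x<z , <-trans z<A A<y , y<w)))

circle-neighbourhood : IsCircleGraph G → ∀ v (f : Fin m → Fin n) → Injective _≡_ _≡_ f →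
                       (∀ i → adj G v (f i) ≡ true) → PermutationModel (restrict G f)
circle-neighbourhood {G = G} {m = m} (a , b , _ , distinct , crossing) v f f-injective v~f = record
  { inner           = λ i → inner (hub i)
  ; outer           = λ i → outer (hub i)
  ; inner-injective = inner-injective
  ; agree           = λ {i} {j} i~j →
      crossing-agree (hub i) (hub j) (b<K i) (proj₁ (crossing (f i) (f j) (adjacent-distinct G i~j)) i~j)
  ; disagree        = λ {i} {j} i≁j i≢j →
      let fi≢fj = i≢j ∘ f-injective ; a≢a , _ , b≢b = distinct (f i) (f j) fi≢fj in
      crossing-disagree (hub i) (hub j) (b<K j) a≢a b≢b
        (λ cross → true≢false (trans (sym (proj₂ (crossing (f i) (f j) fi≢fj) cross)) i≁j))
  }
  where
  K : ℕ
  K = suc (max 0 (map (b ∘ f) (allFin m)))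
  open HubChord (a v) (b v) K

  b<K : ∀ i → b (f i) < K
  b<K i = s≤s (All.lookup (xs≤max 0 (map (b ∘ f) (allFin m))) (∈-map⁺ (b ∘ f) (∈-allFin i)))

  hub : ∀ i → ChordsCross (a v) (b v) (a (f i)) (b (f i))
  hub i = proj₁ (crossing v (f i) (adjacent-distinct G (v~f i))) (v~f i)

  inner-injective : Injective _≡_ _≡_ (λ i → inner (hub i))
  inner-injective {i} {j} same with i ≟ j
  ... | yes i≡j = i≡j
  ... | no i≢j
    with hub i | hub j | distinct (f i) (f j) (i≢j ∘ f-injective) | distinct (f j) (f i) (i≢j ∘ f-injective ∘ sym)
  ...   | inj₁ _ | inj₁ _ | a≢a , _   , _   | _           = ⊥-elim (a≢a same)
  ...   | inj₁ _ | inj₂ _ | _   , a≢b , _   | _           = ⊥-elim (a≢b same)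
  ...   | inj₂ _ | inj₁ _ | _               | _ , a≢b , _ = ⊥-elim (a≢b (sym same))
  ...   | inj₂ _ | inj₂ _ | _   , _   , b≢b | _           = ⊥-elim (b≢b same)

W5-not-circle : ¬ IsCircleGraph W5
W5-not-circle circle = rim-not-permutation (circle-neighbourhood {G = W5} circle zero suc suc-injective λ _ → refl)

_≟ᵈ_ : DecidableEquality (Fin n × Fin n)
_≟ᵈ_ = ≡-dec _≟_ _≟_

darts : Graph n → List (Fin n × Fin n)
darts {n} G = filter (λ (u , v) → adj G u v ≟ᵇ true) (cartesianProduct (allFin n) (allFin n))

dart∈darts : ∀ {G : Graph n} {d} → Dart G d → d ∈ darts G
dart∈darts {d = u , v} uv = ∈-filter⁺ _ (∈-cartesianProduct⁺ (∈-allFin u) (∈-allFin v)) uv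

combine-pair-injective : ∀ {d e : Fin n × Fin n} → uncurry combine d ≡ uncurry combine e → d ≡ e
combine-pair-injective {d = u , v} {e = u′ , v′} same =
  let u≡u′ , v≡v′ = combine-injective u v u′ v′ same in cong₂ _,_ u≡u′ v≡v′

MinDegree₂ : Graph n → Set
MinDegree₂ G = ∀ v → ∃₂ λ w₁ w₂ → w₁ ≢ w₂ × adj G v w₁ ≡ true × adj G v w₂ ≡ true

minDegree₂? : (G : Graph n) → Dec (MinDegree₂ G)
minDegree₂? G =
  all? λ v → any? λ w₁ → any? λ w₂ → ¬? (w₁ ≟ w₂) ×-dec adj G v w₁ ≟ᵇ true ×-dec adj G v w₂ ≟ᵇ true

-- isolated v x: x is a neighbour of v without common neighbours, so both angles at v beside x
-- are bad; pendant v x y z: y is the only common neighbour of v and x, and z is a third neighbour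
-- of v, so one of those two angles is bad.
data AngleCertificate (n : ℕ) : Set where
  isolated : (v x : Fin n) → AngleCertificate n
  pendant  : (v x y z : Fin n) → AngleCertificate n

apex : AngleCertificate n → Fin n
apex (isolated v _)     = v
apex (pendant v _ _ _)  = v

value : AngleCertificate n → ℕ
value (isolated _ _)    = 2
value (pendant _ _ _ _) = 1

ValidCertificate : Graph n → AngleCertificate n → Set
ValidCertificate G (isolated v x) =
  adj G v x ≡ true × (∀ y → adj G v y ≡ true → adj G x y ≡ false)
ValidCertificate G (pendant v x y z) =
  adj G v x ≡ true × (∀ t → adj G v t ≡ true → adj G x t ≡ true → t ≡ y) × adj G v z ≡ true × z ≢ x × z ≢ y

validCertificate? : (G : Graph n) → Decidable₁ (ValidCertificate G)
validCertificate? G (isolated v x) =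
  adj G v x ≟ᵇ true ×-dec all? λ y → adj G v y ≟ᵇ true →-dec adj G x y ≟ᵇ false
validCertificate? G (pendant v x y z) =
  adj G v x ≟ᵇ true ×-dec (all? λ t → adj G v t ≟ᵇ true →-dec adj G x t ≟ᵇ true →-dec t ≟ y)
  ×-dec adj G v z ≟ᵇ true ×-dec ¬? (z ≟ x) ×-dec ¬? (z ≟ y)

module FaceCounting {n : ℕ} {G : Graph n} (ρ : Rotation G) (two-neighbours : MinDegree₂ G) where

  φ : Fin n × Fin n → Fin n × Fin n
  φ = faceStep ρ

  adj-flip : ∀ {u v} → adj G u v ≡ true → adj G v u ≡ true
  adj-flip {u} {v} uv = trans (adj-sym G v u) uv

  dart-φ : ∀ {d} → Dart G d → Dart G (φ d)
  dart-φ {u , v} uv = closed ρ v u (adj-flip uv)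

  φ-injective : ∀ {d e} → Dart G d → Dart G e → φ d ≡ φ e → d ≡ e
  φ-injective {u , v} {u′ , v′} uv u′v′ same with cong proj₁ same
  ... | refl = cong (_, v) (inj ρ v u u′ (adj-flip uv) (adj-flip u′v′) (cong proj₂ same))

  open Orbits φ (Dart G) dart-φ φ-injective (uncurry combine) combine-pair-injective

  next-moves : ∀ {v u} → adj G v u ≡ true → next ρ v u ≢ u
  next-moves {v} {u} vu fixed with two-neighbours v
  ... | w₁ , w₂ , w₁≢w₂ , vw₁ , vw₂ = w₁≢w₂ (trans (sym (reaches w₁ vw₁)) (reaches w₂ vw₂))
    where
    reaches : ∀ w → adj G v w ≡ true → u ≡ w
    reaches w vw = let k , uw = cyclic ρ v u w vu vw in trans (sym (iter-fixed (next ρ v) fixed k)) uw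

  φ-moves : ∀ {d} → Dart G d → φ d ≢ d
  φ-moves {u , v} uv same = adjacent-distinct G uv (sym (cong proj₁ same))

  φ²-moves : ∀ {d} → Dart G d → φ (φ d) ≢ d
  φ²-moves {u , v} uv same = next-moves (adj-flip uv) (cong proj₁ same)

  -- The angle that the dart (u , v) opens at v is not a triangle; a face through such a dart has
  -- length at least four.
  Bad : Fin n × Fin n → Set
  Bad (u , v) = adj G u (next ρ v u) ≡ false

  weight badness : Fin n × Fin n → ℕ
  weight  (u , v) = if adj G u (next ρ v u) then 4 else 3
  badness (u , v) = if adj G u (next ρ v u) then 0 else 1

  weight+badness : ∀ d → weight d + badness d ≡ 4
  weight+badness (u , v) with adj G u (next ρ v u)
  ... | true  = refl
  ... | false = refl

  weight≥3 : ∀ d → 3 ≤ weight d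
  weight≥3 (u , v) with adj G u (next ρ v u)
  ... | true  = s≤s (s≤s (s≤s z≤n))
  ... | false = ≤-refl

  triangle-weight : ∀ {d} → Dart G d → iter φ 3 d ≡ d → weight d ≡ 4
  triangle-weight {u , v} uv closes with adj G u (next ρ v u) in closing-edge
  ... | true  = refl
  ... | false = ⊥-elim (true≢false (trans (sym (adj-flip closing-dart)) closing-edge))
    where
    closing-dart : adj G (next ρ v u) u ≡ true
    closing-dart = subst (λ x → adj G (next ρ v u) x ≡ true) (cong proj₁ closes) (iter-closed uv 2)

  faceSample : Fin n × Fin n → List (Fin n × Fin n)
  faceSample r with iter φ 3 r ≟ᵈ r
  ... | yes _ = r ∷ φ r ∷ φ (φ r) ∷ []
  ... | no _  = r ∷ φ r ∷ φ (φ r) ∷ φ (φ (φ r)) ∷ []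

  faceSample-weight : ∀ {r} → Dart G r → 12 ≤ sum (map weight (faceSample r))
  faceSample-weight {r} dr with iter φ 3 r ≟ᵈ r
  ... | yes closes rewrite triangle-weight dr closes | triangle-weight (iter-closed dr 1) (cong φ closes)
                         | triangle-weight (iter-closed dr 2) (cong (φ ∘ φ) closes) = ≤-refl
  ... | no _ =
    +-mono-≤ (weight≥3 r) (+-mono-≤ (weight≥3 (φ r)) (+-mono-≤ (weight≥3 (φ (φ r))) (+-mono-≤ (weight≥3 (φ (φ (φ r)))) z≤n)))

  faceSample-unique : ∀ {r} → Dart G r → Unique (faceSample r)
  faceSample-unique {r} dr with iter φ 3 r ≟ᵈ r
  ... | yes _ = (≢-sym (φ-moves dr) ∷ ≢-sym (φ²-moves dr) ∷ [])
              ∷ (≢-sym (φ-moves (dart-φ dr)) ∷ [])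
              ∷ [] ∷ []
  ... | no open-face = (≢-sym (φ-moves dr) ∷ ≢-sym (φ²-moves dr) ∷ ≢-sym open-face ∷ [])
                     ∷ (≢-sym (φ-moves (dart-φ dr)) ∷ ≢-sym (φ²-moves (dart-φ dr)) ∷ [])
                     ∷ (≢-sym (φ-moves (iter-closed dr 2)) ∷ [])
                     ∷ [] ∷ []

  faceSample-orbit : ∀ {r x} → x ∈ faceSample r → SameFace ρ r x
  faceSample-orbit {r} x∈ with iter φ 3 r ≟ᵈ r
  faceSample-orbit x∈ | yes _ with x∈
  ... | here refl                 = 0 , refl
  ... | there (here refl)         = 1 , refl
  ... | there (there (here refl)) = 2 , refl
  faceSample-orbit x∈ | no _ with x∈
  ... | here refl                         = 0 , refl
  ... | there (here refl)                 = 1 , refl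
  ... | there (there (here refl))         = 2 , refl
  ... | there (there (there (here refl))) = 3 , refl

  faceSamples-disjoint : ∀ {r r′} → Dart G r → Dart G r′ → ¬ SameFace ρ r r′ →
                         Disjoint (faceSample r) (faceSample r′)
  faceSamples-disjoint {r} {r′} dr dr′ different (x∈ , x∈′) with faceSample-orbit x∈ | faceSample-orbit x∈′
  ... | i , refl | j , same with ≤-total j i
  ...   | inj₁ j≤i with m≤n⇒∃[o]m+o≡n j≤i
  ...     | t , j+t≡i = different (t , iter-cancel j (iter-closed dr t) dr′ (begin
    iter φ j (iter φ t r) ≡⟨ iter-+ φ j t r ⟨
    iter φ (j + t) r      ≡⟨ cong (λ k → iter φ k r) j+t≡i ⟩
    iter φ i r            ≡⟨ same ⟨
    iter φ j r′           ∎))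
    where open ≡-Reasoning
  faceSamples-disjoint {r} {r′} dr dr′ different _ | i , refl | j , same | inj₂ i≤j with m≤n⇒∃[o]m+o≡n i≤j
  ...     | t , i+t≡j = different (orbit-sym dr′ t (iter-cancel i (iter-closed dr′ t) dr (begin
    iter φ i (iter φ t r′) ≡⟨ iter-+ φ i t r′ ⟨
    iter φ (i + t) r′      ≡⟨ cong (λ k → iter φ k r′) i+t≡j ⟩
    iter φ j r′            ≡⟨ same ⟩
    iter φ i r             ∎)))
    where open ≡-Reasoning

  faceSamples : List (Fin n × Fin n) → List (Fin n × Fin n)
  faceSamples = concatMap faceSample

  faceSamples-unique : ∀ {R} → All (Dart G) R → AllPairs (λ r r′ → ¬ SameFace ρ r r′) R → Unique (faceSamples R)
  faceSamples-unique {[]}    _         _               = []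
  faceSamples-unique {r ∷ R} (dr ∷ dR) (apart ∷ apartR) =
    Unique.++⁺ (faceSample-unique dr) (faceSamples-unique dR apartR) disjoint
    where
    disjoint : Disjoint (faceSample r) (faceSamples R)
    disjoint (x∈ , x∈R) = let r′ , r′∈R , x∈′ = find (∈-concatMap⁻ faceSample {xs = R} x∈R) in
      faceSamples-disjoint dr (All.lookup dR r′∈R) (All.lookup apart r′∈R) (x∈ , x∈′)

  faceSamples-weight : ∀ {R} → All (Dart G) R → 12 * length R ≤ sum (map weight (faceSamples R))
  faceSamples-weight {[]}    []        = z≤n
  faceSamples-weight {r ∷ R} (dr ∷ dR) = begin
    12 * length (r ∷ R)                                            ≡⟨ *-suc 12 (length R) ⟩
    12 + 12 * length R                                             ≤⟨ +-mono-≤ (faceSample-weight dr) (faceSamples-weight dR) ⟩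
    sum (map weight (faceSample r)) + sum (map weight (faceSamples R)) ≡⟨ sum-++ (map weight (faceSample r)) _ ⟨
    sum (map weight (faceSample r) ++ map weight (faceSamples R))  ≡⟨ cong sum (map-++ weight (faceSample r) (faceSamples R)) ⟨
    sum (map weight (faceSamples (r ∷ R)))                         ∎
    where open ≤-Reasoning

  faceSamples-darts : ∀ {R} → All (Dart G) R → faceSamples R ⊆ darts G
  faceSamples-darts {R} dR x∈ = let r , r∈R , x∈r = find (∈-concatMap⁻ faceSample {xs = R} x∈) in
    dart∈darts {G = G} (let k , rx = faceSample-orbit x∈r in subst (Dart G) rx (iter-closed (All.lookup dR r∈R) k))

  sum-badness : ∀ {L} → All Bad L → sum (map badness L) ≡ length L
  sum-badness {[]}          []          = refl
  sum-badness {(u , v) ∷ L} (bad ∷ bads) rewrite bad = cong suc (sum-badness bads)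

  face-bound : ∀ {R L} → All (Dart G) R → AllPairs (λ r r′ → ¬ SameFace ρ r r′) R →
               Unique L → All Bad L → All (Dart G) L → 12 * length R + length L ≤ 4 * length (darts G)
  face-bound {R} {L} dR apart uL bad dL = begin
    12 * length R + length L
      ≤⟨ +-mono-≤ (≤-trans (faceSamples-weight dR)
                           (sum-unique-⊆ weight (faceSamples-unique dR apart) (faceSamples-darts dR)))
                  (subst (_≤ sum (map badness (darts G))) (sum-badness bad)
                         (sum-unique-⊆ badness uL (dart∈darts {G = G} ∘ All.lookup dL))) ⟩
    sum (map weight (darts G)) + sum (map badness (darts G))
      ≡⟨ sum-complementary weight+badness (darts G) ⟩
    4 * length (darts G) ∎
    where open ≤-Reasoning

  predecessor : ∀ {v x} → adj G v x ≡ true → ∃ λ p → adj G v p ≡ true × next ρ v p ≡ x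
  predecessor {v} {x} vx with cyclic ρ v (next ρ v x) x (closed ρ v x vx) vx
  ... | zero  , fixed   = x , vx , fixed
  ... | suc k , reached = iter (next ρ v) k (next ρ v x) , around k , reached
    where
    around : ∀ k → adj G v (iter (next ρ v) k (next ρ v x)) ≡ true
    around zero    = closed ρ v x vx
    around (suc k) = closed ρ v _ (around k)

  isolated-bad : ∀ {v x} → adj G v x ≡ true → (∀ y → adj G v y ≡ true → adj G x y ≡ false) →
                 ∃ λ p → p ≢ x × Bad (x , v) × Bad (p , v) × Dart G (x , v) × Dart G (p , v)
  isolated-bad {v} {x} vx no-common with predecessor vx
  ... | p , vp , px = p , (λ { refl → next-moves vx px }) , no-common _ (closed ρ v x vx) ,
                      subst (λ y → adj G p y ≡ false) (sym px) (trans (adj-sym G p x) (no-common p vp)) ,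
                      adj-flip vx , adj-flip vp

  pendant-bad : ∀ {v x y z} → adj G v x ≡ true → (∀ t → adj G v t ≡ true → adj G x t ≡ true → t ≡ y) →
                adj G v z ≡ true → z ≢ x → z ≢ y → ∃ λ u → Bad (u , v) × Dart G (u , v)
  pendant-bad {v} {x} {y} {z} vx only-y vz z≢x z≢y with predecessor vx
  ... | p , vp , px with adj G x (next ρ v x) in x-closes | adj G p x in p-closes
  ...   | false | _     = x , x-closes , adj-flip vx
  ...   | true  | false = p , subst (λ w → adj G p w ≡ false) (sym px) p-closes , adj-flip vp
  ...   | true  | true  = ⊥-elim (z∉orbit (cyclic ρ v x z vx vz))
    where
    x→y : next ρ v x ≡ y
    x→y = only-y _ (closed ρ v x vx) x-closes
    y→x : next ρ v y ≡ x
    y→x = subst (λ w → next ρ v w ≡ x) (only-y p vp (trans (adj-sym G x p) p-closes)) px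
    orbit : ∀ k → iter (next ρ v) k x ≡ x ⊎ iter (next ρ v) k x ≡ y
    orbit zero = inj₁ refl
    orbit (suc k) with orbit k
    ... | inj₁ at-x = inj₂ (trans (cong (next ρ v) at-x) x→y)
    ... | inj₂ at-y = inj₁ (trans (cong (next ρ v) at-y) y→x)
    z∉orbit : ∃ (λ k → iter (next ρ v) k x ≡ z) → ⊥
    z∉orbit (k , reached) with orbit k
    ... | inj₁ at-x = z≢x (trans (sym reached) at-x)
    ... | inj₂ at-y = z≢y (trans (sym reached) at-y)

  BadDartsAt : List (Fin n) → List (Fin n × Fin n) → Set
  BadDartsAt vs L = Unique L × All (λ d → Bad d × Dart G d × proj₂ d ∈ vs) L

  certified-bad-darts : ∀ c → ValidCertificate G c → ∃ λ L → length L ≡ value c × BadDartsAt (apex c ∷ []) L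
  certified-bad-darts (isolated v x) (vx , no-common) with isolated-bad vx no-common
  ... | p , p≢x , x-bad , p-bad , xv , pv =
    (x , v) ∷ (p , v) ∷ [] , refl , ((λ same → p≢x (sym (cong proj₁ same))) ∷ []) ∷ [] ∷ [] ,
    (x-bad , xv , here refl) ∷ (p-bad , pv , here refl) ∷ []
  certified-bad-darts (pendant v x y z) (vx , only-y , vz , z≢x , z≢y) with pendant-bad vx only-y vz z≢x z≢y
  ... | u , u-bad , uv = (u , v) ∷ [] , refl , [] ∷ [] , (u-bad , uv , here refl) ∷ []

  all-certified-bad-darts : ∀ cs → All (ValidCertificate G) cs → Unique (map apex cs) →
                            ∃ λ L → length L ≡ sum (map value cs) × BadDartsAt (map apex cs) L
  all-certified-bad-darts []       []            _                 = [] , refl , [] , []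
  all-certified-bad-darts (c ∷ cs) (valid ∷ vs) (c∉cs ∷ unique)
    with certified-bad-darts c valid | all-certified-bad-darts cs vs unique
  ... | L , |L| , uL , bL | L′ , |L′| , uL′ , bL′ =
    L ++ L′ , trans (length-++ L) (cong₂ _+_ |L| |L′|) ,
    Unique.++⁺ uL uL′ (λ (d∈L , d∈L′) → apart (proj₂ (proj₂ (All.lookup bL d∈L)))
                                              (proj₂ (proj₂ (All.lookup bL′ d∈L′)))) ,
    All.++⁺ (All.map (λ { (b , d , here at-c) → b , d , here at-c }) bL) (All.map (λ (b , d , h) → b , d , there h) bL′)
    where
    apart : ∀ {w} → w ∈ apex c ∷ [] → w ∈ map apex cs → ⊥
    apart (here refl) w∈cs = All.lookup c∉cs w∈cs refl

euler-bound : ∀ {n F I E C K D} → n + F + I ≡ E + 2 * C → 1 ≤ C → 12 * F + K ≤ 4 * D →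
              12 * (E + 2) + K ≤ 12 * (n + I) + 4 * D
euler-bound {n} {F} {I} {E} {C} {K} {D} euler C≥1 faces = begin
  12 * (E + 2) + K          ≤⟨ +-monoˡ-≤ K (*-monoʳ-≤ 12 (+-monoʳ-≤ E (*-monoʳ-≤ 2 C≥1))) ⟩
  12 * (E + 2 * C) + K      ≡⟨ cong (λ m → 12 * m + K) euler ⟨
  12 * (n + F + I) + K      ≡⟨ regroup n F I K ⟩
  12 * (n + I) + (12 * F + K) ≤⟨ +-monoʳ-≤ (12 * (n + I)) faces ⟩
  12 * (n + I) + 4 * D      ∎
  where
  open ≤-Reasoning
  open +-*-Solver
  regroup : ∀ n F I K → 12 * (n + F + I) + K ≡ 12 * (n + I) + (12 * F + K)
  regroup = solve 4 (λ n F I K → con 12 :* (n :+ F :+ I) :+ K := con 12 :* (n :+ I) :+ (con 12 :* F :+ K)) refl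

components-nonempty : ∀ {G : Graph (suc n)} {C} → ComponentReps G C → 1 ≤ length C
components-nonempty {C = []}    (covers , _) with () ← covers zero
components-nonempty {C = _ ∷ _} _            = s≤s z≤n

EulerExcess : Graph n → List (AngleCertificate n) → Set
EulerExcess {n} G cs = 12 * (n + numIsolated G) + 4 * length (darts G) < 12 * (numEdges G + 2) + sum (map value cs)

eulerExcess? : (G : Graph n) (cs : List (AngleCertificate n)) → Dec (EulerExcess G cs)
eulerExcess? {n} G cs = 12 * (n + numIsolated G) + 4 * length (darts G) <? 12 * (numEdges G + 2) + sum (map value cs)

¬planar : (G : Graph (suc n)) (cs : List (AngleCertificate (suc n))) → MinDegree₂ G →
          All (ValidCertificate G) cs → Unique (map apex cs) → EulerExcess G cs → ¬ Planar G
¬planar {n} G cs two-neighbours valid distinct excess (ρ , R , C , (dR , _ , apart) , components , euler) =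
  let open FaceCounting ρ two-neighbours
      L , |L| , uL , bL = all-certified-bad-darts cs valid distinct
  in <⇒≱ excess (euler-bound {n = suc n} {F = length R} {I = numIsolated G} {E = numEdges G} {C = length C}
                             {K = sum (map value cs)} {D = length (darts G)} euler (components-nonempty components)
       (subst (λ k → 12 * length R + k ≤ 4 * length (darts G)) |L|
         (face-bound dR apart uL (All.map proj₁ bL) (All.map (proj₁ ∘ proj₂) bL))))

span : Fin n → Fin n → SpanTree n 2 → SpanTree n 2 → SpanTree n 2
span r₁ r₂ = node (r₁ ∷ r₂ ∷ [])

record Certificate (G : Graph 10) : Set where
  field
    radius          : ℕ
    clique          : List (Fin 10)
    independent     : List (Fin 10)
    decomposition   : SpanTree 10 2
    -- wheel embeds W5 into the graph obtained by local complementation at the pivots in turn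
    pivots          : List (Fin 10)
    wheel           : Vec (Fin 10) 6
    angles          : List (AngleCertificate 10)
    irregularVertex : Fin 10

  Checks : Set
  Checks = ReachableWithin G zero radius
         × (Homogeneous G true clique × length clique ≡ 4 × ¬ T (hasHomogeneous G true (suc (length clique))))
         × (Homogeneous G false independent × length independent ≤ 3
            × ¬ T (hasHomogeneous G false (suc (length independent))))
         × (IsRankDecomposition (shape decomposition) × Certified G decomposition × AllPairsNonsingular G)
         × IsInducedEmbedding W5 (localComplements G pivots) (lookup wheel)
         × (MinDegree₂ G × All (ValidCertificate G) angles × Unique (map apex angles)
            × EulerExcess G angles)
         × (degree G irregularVertex ≢ 3 × degree G irregularVertex ≢ 6)

  checks? : Dec Checks
  checks? = all? (λ u → T? (is-just (walkWithin G radius u zero)))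
    ×-dec (homogeneous? G true clique ×-dec length clique ≟ℕ 4 ×-dec ¬? (T? (hasHomogeneous G true (suc (length clique)))))
    ×-dec (homogeneous? G false independent ×-dec length independent ≤? 3
           ×-dec ¬? (T? (hasHomogeneous G false (suc (length independent)))))
    ×-dec (isRankDecomposition? (shape decomposition) ×-dec certified? G decomposition ×-dec allPairsNonsingular? G)
    ×-dec isInducedEmbedding? W5 (localComplements G pivots) (lookup wheel)
    ×-dec (minDegree₂? G ×-dec All.all? (validCertificate? G) angles ×-dec unique? (map apex angles)
           ×-dec eulerExcess? G angles)
    ×-dec (¬? (degree G irregularVertex ≟ℕ 3) ×-dec ¬? (degree G irregularVertex ≟ℕ 6))

Properties : Graph 10 → Set
Properties G =
  (Connected G × ¬ Planar G × Girth G 3) ×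
  (CliqueNumber G 4 × RankWidth G 2) ×
  (Σ ℕ λ a → IndependenceNumber G a × a ≤ 3) ×
  (¬ (G ≅ Petersen) × ¬ (G ≅ complement Petersen)) ×
  (¬ IsCircleGraph G × VertexMinor W5 G)

checked-properties : (c : Certificate G) → Certificate.Checks c → Properties G
checked-properties {G = G} c
  (reachable , (K , |K|≡4 , ¬larger-clique) , (I , |I|≤3 , ¬larger-independent) ,
   (isDecomposition , spanned , nonsingular) , W5↪G′ , (two-neighbours , validAngles , distinctApices , excess) ,
   (≢3 , ≢6)) =
  ( connected-within G zero radius reachable
  , ¬planar G angles two-neighbours validAngles distinctApices excess
  , triangle-girth K (subst (3 ≤_) (sym |K|≡4) (s≤s (s≤s (s≤s z≤n)))) ) ,
  ( subst (CliqueNumber G) |K|≡4 (largest-homogeneous G true K ¬larger-clique)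
  , rankWidthAtMost decomposition isDecomposition spanned , rankWidth≥2 G nonsingular ) ,
  ( length independent , largest-homogeneous G false I ¬larger-independent , |I|≤3 ) ,
  ( ≇-regular G Petersen Petersen-regular irregularVertex ≢3
  , ≇-regular G (complement Petersen) complement-Petersen-regular irregularVertex ≢6 ) ,
  ( (λ circle → W5-not-circle
      (circle-induced {G = localComplements G pivots} {H = W5} (circle-lc {G = G} pivoting circle) W5↪G′))
  , induced⇒vertexMinor {H = W5} pivoting W5↪G′ )
  where
  open Certificate c
  pivoting : LCReach G (localComplements G pivots)
  pivoting = lcReach-localComplements G pivots

certified : (c : Certificate G) → {True (Certificate.checks? c)} → Properties G
certified c {valid} = checked-properties c (toWitness valid)

G1-certificate : Certificate G1
G1-certificate = record
  { radius          = 2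
  ; clique          = # 0 ∷ # 3 ∷ # 7 ∷ # 9 ∷ []
  ; independent     = # 0 ∷ # 1 ∷ # 2 ∷ []
  ; decomposition   =
      span (# 0) (# 0)
        (span (# 0) (# 4)
          (span (# 4) (# 5)
            (span (# 0) (# 5)
              (span (# 0) (# 6) (leaf (# 0)) (leaf (# 6)))
              (span (# 3) (# 5) (leaf (# 3)) (leaf (# 5))))
            (span (# 4) (# 7)
              (span (# 4) (# 9) (leaf (# 4)) (leaf (# 9)))
              (span (# 7) (# 8) (leaf (# 7)) (leaf (# 8)))))
          (leaf (# 2)))
        (leaf (# 1))
  ; pivots          = []
  ; wheel           = # 7 ∷ # 0 ∷ # 3 ∷ # 6 ∷ # 2 ∷ # 5 ∷ []
  ; angles          = []
  ; irregularVertex = # 0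
  }

G2-certificate : Certificate G2
G2-certificate = record
  { radius          = 2
  ; clique          = # 0 ∷ # 3 ∷ # 7 ∷ # 9 ∷ []
  ; independent     = # 0 ∷ # 1 ∷ # 2 ∷ []
  ; decomposition   =
      span (# 0) (# 0)
        (span (# 0) (# 4)
          (span (# 4) (# 5)
            (span (# 0) (# 5)
              (span (# 0) (# 6) (leaf (# 0)) (leaf (# 6)))
              (span (# 3) (# 5) (leaf (# 3)) (leaf (# 5))))
            (span (# 4) (# 7)
              (span (# 4) (# 9) (leaf (# 4)) (leaf (# 9)))
              (span (# 7) (# 8) (leaf (# 7)) (leaf (# 8)))))
          (leaf (# 2)))
        (leaf (# 1))
  ; pivots          = []
  ; wheel           = # 7 ∷ # 0 ∷ # 3 ∷ # 6 ∷ # 2 ∷ # 5 ∷ []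
  ; angles          = []
  ; irregularVertex = # 0
  }

G3-certificate : Certificate G3
G3-certificate = record
  { radius          = 3
  ; clique          = # 2 ∷ # 5 ∷ # 7 ∷ # 9 ∷ []
  ; independent     = # 0 ∷ # 1 ∷ # 2 ∷ []
  ; decomposition   =
      span (# 0) (# 0)
        (span (# 0) (# 4)
          (span (# 4) (# 5)
            (span (# 3) (# 5)
              (span (# 0) (# 6) (leaf (# 0)) (leaf (# 6)))
              (span (# 3) (# 5) (leaf (# 3)) (leaf (# 5))))
            (span (# 4) (# 7)
              (span (# 4) (# 9) (leaf (# 4)) (leaf (# 9)))
              (span (# 7) (# 8) (leaf (# 7)) (leaf (# 8)))))
          (leaf (# 2)))
        (leaf (# 1))
  ; pivots          = # 0 ∷ []
  ; wheel           = # 5 ∷ # 0 ∷ # 3 ∷ # 7 ∷ # 2 ∷ # 6 ∷ []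
  ; angles          = isolated (# 0) (# 5) ∷ isolated (# 1) (# 7) ∷ isolated (# 2) (# 6) ∷ isolated (# 3) (# 8)
                    ∷ isolated (# 4) (# 9) ∷ isolated (# 5) (# 0) ∷ isolated (# 6) (# 2) ∷ []
  ; irregularVertex = # 2
  }

G4-certificate : Certificate G4
G4-certificate = record
  { radius          = 3
  ; clique          = # 2 ∷ # 6 ∷ # 8 ∷ # 9 ∷ []
  ; independent     = # 0 ∷ # 1 ∷ # 2 ∷ []
  ; decomposition   =
      span (# 0) (# 0)
        (span (# 0) (# 4)
          (span (# 4) (# 5)
            (span (# 3) (# 5)
              (span (# 0) (# 9) (leaf (# 0)) (leaf (# 9)))
              (span (# 3) (# 5) (leaf (# 3)) (leaf (# 5))))
            (span (# 4) (# 6)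
              (span (# 4) (# 8) (leaf (# 4)) (leaf (# 8)))
              (span (# 6) (# 7) (leaf (# 6)) (leaf (# 7)))))
          (leaf (# 2)))
        (leaf (# 1))
  ; pivots          = []
  ; wheel           = # 8 ∷ # 1 ∷ # 4 ∷ # 7 ∷ # 2 ∷ # 6 ∷ []
  ; angles          = pendant (# 0) (# 3) (# 9) (# 5) ∷ pendant (# 1) (# 4) (# 8) (# 6) ∷ pendant (# 2) (# 5) (# 9) (# 6)
                    ∷ pendant (# 3) (# 0) (# 9) (# 6) ∷ pendant (# 4) (# 1) (# 8) (# 7) ∷ []
  ; irregularVertex = # 2
  }

G5-certificate : Certificate G5
G5-certificate = record
  { radius          = 3
  ; clique          = # 2 ∷ # 6 ∷ # 7 ∷ # 9 ∷ []
  ; independent     = # 0 ∷ # 1 ∷ # 2 ∷ []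
  ; decomposition   =
      span (# 0) (# 0)
        (span (# 0) (# 4)
          (span (# 4) (# 5)
            (span (# 3) (# 5)
              (span (# 0) (# 9) (leaf (# 0)) (leaf (# 9)))
              (span (# 3) (# 5) (leaf (# 3)) (leaf (# 5))))
            (span (# 4) (# 6)
              (span (# 4) (# 8) (leaf (# 4)) (leaf (# 8)))
              (span (# 6) (# 7) (leaf (# 6)) (leaf (# 7)))))
          (leaf (# 2)))
        (leaf (# 1))
  ; pivots          = []
  ; wheel           = # 9 ∷ # 0 ∷ # 3 ∷ # 6 ∷ # 2 ∷ # 5 ∷ []
  ; angles          = isolated (# 1) (# 6) ∷ isolated (# 4) (# 7) ∷ isolated (# 6) (# 1) ∷ isolated (# 7) (# 4)
                    ∷ pendant (# 0) (# 3) (# 9) (# 5) ∷ []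
  ; irregularVertex = # 2
  }

G6-certificate : Certificate G6
G6-certificate = record
  { radius          = 2
  ; clique          = # 0 ∷ # 2 ∷ # 5 ∷ # 7 ∷ []
  ; independent     = # 0 ∷ # 1 ∷ []
  ; decomposition   =
      span (# 0) (# 0)
        (span (# 0) (# 3)
          (span (# 0) (# 3)
            (span (# 0) (# 5)
              (span (# 0) (# 9) (leaf (# 0)) (leaf (# 9)))
              (span (# 5) (# 6)
                (span (# 5) (# 8) (leaf (# 5)) (leaf (# 8)))
                (span (# 6) (# 7) (leaf (# 6)) (leaf (# 7)))))
            (span (# 3) (# 4) (leaf (# 3)) (leaf (# 4))))
          (leaf (# 2)))
        (leaf (# 1))
  ; pivots          = []
  ; wheel           = # 0 ∷ # 5 ∷ # 7 ∷ # 9 ∷ # 6 ∷ # 8 ∷ []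
  ; angles          = []
  ; irregularVertex = # 0
  }

proposition5p2 : (G : Graph 10) → G ∈ sixGraphs →
    (Connected G × ¬ Planar G × Girth G 3) ×
    (CliqueNumber G 4 × RankWidth G 2) ×
    (Σ ℕ λ a → IndependenceNumber G a × a ≤ 3) ×
    (¬ (G ≅ Petersen) × ¬ (G ≅ complement Petersen)) ×
    (¬ IsCircleGraph G × VertexMinor W5 G)
proposition5p2 .G1 (here refl)                                   = certified G1-certificate
proposition5p2 .G2 (there (here refl))                           = certified G2-certificate
proposition5p2 .G3 (there (there (here refl)))                   = certified G3-certificate
proposition5p2 .G4 (there (there (there (here refl))))           = certified G4-certificate
proposition5p2 .G5 (there (there (there (there (here refl)))))   = certified G5-certificate
proposition5p2 .G6 (there (there (there (there (there (here refl)))))) = certified G6-certificate
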